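{- There exist arbitrarily large happy directed temporal graphs of constant lifetime, and arbitrarily large simple undirected temporal graphs of constant lifetime in the strict setting, that are temporally connected but have no nontrivial closed tcc other than their whole vertex set.
   Context: A temporal graph is a pair $\mathcal{G}=(G,\lambda)$ with $G=(V,E)$ a finite (directed or undirected) graph and $\lambda:E\to2^{\mathbb{N}}$ assigning nonempty label sets; lifetime = largest label; "constant lifetime" means the lifetime is bounded by a fixed constant independent of the size. A temporal path is a path $(e_1,\dots,e_m)$ of $G$ (respecting arc directions if directed) with labels $t_i\in\lambda(e_i)$, $t_1\le\dots\le t_m$ (strict setting: $t_1<\dots<t_m$). $\mathcal{G}$ is temporally connected (TC) if every ordered pair of distinct vertices is joined by a temporal path. Simple: one label per edge. Happy: simple and proper (directed: no vertex has an in-arc and an out-arc with a common label). $S\subseteq V$ is a closed tcc if the induced temporal subgraph $\mathcal{G}[S]$ is TC; it is nontrivial if $|S|\ge 2$ (directed) or $|S|\ge3$ (undirected). -}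

module Defs where

open import Data.Nat using (ℕ; _≤_; _<_)
open import Data.Fin using (Fin)
open import Data.Fin.Subset using (Subset; _∈_; ∣_∣)
open import Data.Maybe using (Maybe; just; nothing)
open import Data.List using (List; []; _∷_; [_])
open import Data.List.Relation.Unary.All using (All)
open import Data.List.Relation.Unary.Unique.Propositional using (Unique)
open import Data.Product using (Σ; _×_; ∃)
open import Data.Unit using (⊤)
open import Data.Empty using (⊥)
import Data.Fin.Subset
open import Relation.Binary.PropositionalEquality using (_≡_; _≢_)
open import Relation.Nullary using (¬_)

-- A SIMPLE temporal graph on vertex set Fin k is encoded by a partial
-- labelling  lab : Fin k → Fin k → Maybe ℕ :
--   lab u v ≡ just t   iff  (u,v) is an arc/edge of G and λ((u,v)) = {t};
--   lab u v ≡ nothing  iff  (u,v) is not an arc/edge.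
-- (Simple = exactly one label per edge, so λ(e) is a single natural.)
TLabel : ℕ → Set
TLabel k = Fin k → Fin k → Maybe ℕ

Loopless : ∀ {k} → TLabel k → Set
Loopless lab = ∀ v → lab v v ≡ nothing

-- undirected: the labelling is symmetric
Symmetric : ∀ {k} → TLabel k → Set
Symmetric lab = ∀ u v → lab u v ≡ lab v u

LifetimeAtMost : ∀ {k} → ℕ → TLabel k → Set
LifetimeAtMost L lab = ∀ u v t → lab u v ≡ just t → t ≤ L

ProperDirected : ∀ {k} → TLabel k → Set
ProperDirected lab = ∀ u v w t → lab u v ≡ just t → lab v w ≡ just t → ⊥

-- happy directed temporal graph (simplicity is built into the encoding)
Happy : ∀ {k} → TLabel k → Set
Happy lab = Loopless lab × ProperDirected lab

-- time-respecting condition relative to the previous label (nothing = first arc)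
After : (ℕ → ℕ → Set) → Maybe ℕ → ℕ → Set
After R nothing  t = ⊤
After R (just s) t = R s t

-- TWalk R lab prev u v vs : vs = (u = x0, x1, ..., xm = v) is a walk from u to v
-- in the underlying graph, with labels t_i = λ(x_{i-1} x_i) satisfying
-- R t_i t_{i+1} consecutively (R = _≤_ non-strict, _<_ strict).
data TWalk {k} (R : ℕ → ℕ → Set) (lab : TLabel k) :
           Maybe ℕ → Fin k → Fin k → List (Fin k) → Set where
  here : ∀ {p} v → TWalk R lab p v v [ v ]
  step : ∀ {p} {u w v vs} t → lab u w ≡ just t → After R p t →
         TWalk R lab (just t) w v vs → TWalk R lab p u v (u ∷ vs)

-- temporal path: a temporal walk with pairwise distinct vertices (a path of G)
-- all of whose vertices lie in S (i.e. a temporal path of the induced G[S])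
TPathIn : ∀ {k} → (ℕ → ℕ → Set) → TLabel k → Subset k → Fin k → Fin k → Set
TPathIn {k} R lab S u v =
  Σ (List (Fin k)) λ vs → TWalk R lab nothing u v vs × Unique vs × All (_∈ S) vs

ClosedTCC : ∀ {k} → (ℕ → ℕ → Set) → TLabel k → Subset k → Set
ClosedTCC R lab S = ∀ u v → u ∈ S → v ∈ S → u ≢ v → TPathIn R lab S u v

TemporallyConnected : ∀ {k} → (ℕ → ℕ → Set) → TLabel k → Set
TemporallyConnected {k} R lab = ∀ (u v : Fin k) → u ≢ v → TPathIn R lab (Data.Fin.Subset.⊤) u v

OnlyTrivialTCCs : ∀ {k} → (ℕ → ℕ → Set) → ℕ → TLabel k → Set
OnlyTrivialTCCs {k} R m lab = ∀ (S : Subset k) → m ≤ ∣ S ∣ → ClosedTCC R lab S → ∀ v → v ∈ S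

module Submission where

-- Each graph is a path of leaves ℓ₀ ⋯ ℓₘ₋₁, for arbitrary m, plus a bounded number of other
-- vertices, with labels at most 7 (directed) resp. 8 (undirected).  Temporal connectivity is
-- witnessed by explicit walks: every vertex reaches a hub by time 5 (resp. the root at time 6),
-- and from there every vertex is reached later.
--
-- A closed tcc S is shown to be everything by forcing vertices into it: if x, y ∈ S and every
-- temporal walk from x to y passes through c, then c ∈ S, as G[S] contains such a walk.  Each such
-- claim is an invariant of pairs (current vertex, arrival time) that holds at x, fails at y and
-- survives every time-respecting arc not entering c.  The leaves are forced in order: every walk
-- from ℓₙ to the hub of its own parity (resp. to the collector of its residue mod 3) must start with
-- the arc to ℓₙ₊₁, all other routes arriving too late.  The forcing is started by a rank argument in
-- the directed graph, and in the undirected graph by the fact that a strict closed tcc with at least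
-- three vertices never spans a star.

open import Defs
open import Function using (_∘_)
open import Data.Nat as ℕ using (ℕ; zero; suc; _+_; _≤_; _<_; _≤?_; z≤n; s≤s; z<s; parity)
open import Data.Nat.Properties
  using (≤-trans; <-trans; ≤∧≢⇒<; <-irrefl; <-asym; n<1+n; ≤-refl; <⇒≤; m≤n+m)
open import Data.Parity.Base using (Parity; 0ℙ; 1ℙ; _⁻¹)
open import Data.Parity.Properties as ℙ using (⁻¹-selfInverse; ⁻¹-involutive; suc-homo-⁻¹)
open import Data.Fin as F using (Fin; zero; suc; toℕ; fromℕ<; _↑ʳ_)
open import Data.Fin.Properties using (_≟_; suc-injective; toℕ<n; fromℕ<-toℕ; toℕ-fromℕ<)
open import Data.Fin.Patterns using (0F; 1F; 2F; 3F; 4F; 5F; 6F; 7F; 8F; 9F)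
open import Data.Fin.Subset using (Subset; _∈_; _∉_; ⊤; ∣_∣; Nonempty; inside; outside)
open import Data.Fin.Subset.Properties using (∈⊤; _∈?_)
open import Data.Maybe using (Maybe; just; nothing; _<∣>_)
open import Data.Maybe.Properties using (just-injective)
open import Data.List using (List; []; _∷_)
open import Data.List.Membership.Propositional using () renaming (_∈_ to _∈ₗ_)
open import Data.List.Relation.Unary.Any using (Any; here; there; any?)
open import Data.List.Relation.Unary.All as All using (All; []; _∷_)
open import Data.List.Relation.Unary.All.Properties.Core using (¬Any⇒All¬)
open import Data.List.Relation.Unary.Unique.Propositional using (Unique; []; _∷_)
open import Data.Vec.Base using (_∷_; here; there)
open import Data.Product using (Σ; ∃; ∃₂; _×_; _,_)
open import Data.Sum using (_⊎_; inj₁; inj₂; swap)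
open import Data.Unit using (tt)
import Data.Unit
open import Data.Empty using (⊥; ⊥-elim)
open import Data.Empty.Irrelevant renaming (⊥-elim to ⊥-elim-irr)
open import Relation.Binary.Definitions using (Transitive)
open import Relation.Binary.PropositionalEquality using (_≡_; _≢_; refl; sym; trans; cong; subst; subst₂)
open import Relation.Nullary using (¬_; Dec; yes; no)
open import Relation.Nullary.Decidable
  using (True; False; toWitness; toWitnessFalse; map′; _⊎-dec_; _×-dec_)

variable
  k : ℕ
  R : ℕ → ℕ → Set
  lab : TLabel k
  p q : Maybe ℕ
  s t : ℕ
  u v w : Fin k
  vs : List (Fin k)
  S : Subset k

≤-lit : ∀ {m n} {_ : True (m ≤? n)} → m ≤ n
≤-lit {_} {_} {m≤n} = toWitness m≤n

≰-lit : ∀ {A : Set} {m n} {_ : False (m ≤? n)} → m ≤ n → A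
≰-lit {_} {_} {_} {m≰n} m≤n = ⊥-elim (toWitnessFalse m≰n m≤n)

<⇒≢-irr : ∀ {a b} → .(a < b) → a ≢ b
<⇒≢-irr a<b eq = ⊥-elim-irr (<-irrefl eq a<b)

when : ∀ {A : Set} → Dec A → ℕ → Maybe ℕ
when (yes _) t = just t
when (no _)  _ = nothing

when-sound : ∀ {A : Set} (a? : Dec A) → when a? s ≡ just t → A × s ≡ t
when-sound (yes a) refl = a , refl

when-complete : ∀ {A : Set} (a? : Dec A) → A → when a? t ≡ just t
when-complete (yes _) _ = refl
when-complete (no ¬a) a = ⊥-elim (¬a a)

Adjacent : TLabel k → Fin k → Fin k → Set
Adjacent lab u w = ∃ λ t → lab u w ≡ just t

walk-head : ∀ {P : Fin k → Set} → TWalk R lab p u v vs → P u → Any P vs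
walk-head (here _)       pu = here pu
walk-head (step _ _ _ _) pu = here pu

all-head : ∀ {P : Fin k → Set} → All P vs → TWalk R lab p u v vs → P u
all-head all walk = All.lookup all (walk-head walk refl)

arcs-into-end : TWalk R lab p u v vs → u ≢ v →
  (∃ λ t → lab u v ≡ just t × After R p t) ⊎
  (∃₂ λ x w → ∃₂ λ s t → lab x w ≡ just s × lab w v ≡ just t × R s t × x ∈ₗ vs × w ∈ₗ vs)
arcs-into-end (here _) u≢v = ⊥-elim (u≢v refl)
arcs-into-end {v = v} (step {w = w} t e a rest) _ with w ≟ v
... | yes refl = inj₁ (t , e , a)
... | no w≢v with arcs-into-end rest w≢v
...   | inj₁ (t′ , e′ , a′) =
  inj₂ (_ , w , t , t′ , e , e′ , a′ , here refl , there (walk-head rest refl))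
...   | inj₂ (x , y , s′ , t′ , e₁ , e₂ , r , x∈ , y∈) =
  inj₂ (x , y , s′ , t′ , e₁ , e₂ , r , there x∈ , there y∈)

arc-into-end : TWalk R lab p u v vs → u ≢ v → ∃₂ λ w t → lab w v ≡ just t × w ∈ₗ vs
arc-into-end walk u≢v with arcs-into-end walk u≢v
... | inj₁ (t , e , _)                          = _ , t , e , walk-head walk refl
... | inj₂ (_ , w , _ , t , _ , e , _ , _ , w∈) = w , t , e , w∈

invariant-or-cut : {Inv : Fin k → Maybe ℕ → Set} {Cut : Fin k → Set} →
  (∀ {u p w t} → Inv u p → lab u w ≡ just t → After R p t → Cut w ⊎ Inv w (just t)) →
  TWalk R lab p u v vs → Inv u p → Any Cut vs ⊎ ∃ (Inv v)
invariant-or-cut closed (here _) i = inj₂ (_ , i)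
invariant-or-cut closed (step t e a rest) i with closed i e a
... | inj₁ c  = inj₁ (there (walk-head rest c))
... | inj₂ i′ with invariant-or-cut closed rest i′
...   | inj₁ c = inj₁ (there c)
...   | inj₂ r = inj₂ r

Earlier : (ℕ → ℕ → Set) → Maybe ℕ → Maybe ℕ → Set
Earlier R p q = ∀ {t} → After R q t → After R p t

retime : Earlier R p q → TWalk R lab q u v vs → TWalk R lab p u v vs
retime _ (here v)       = here v
retime f (step t e a w) = step t e (f a) w

module _ (R-trans : Transitive R) where

  after⇒earlier : ∀ p → After R p t → Earlier R p (just t)
  after⇒earlier nothing  _   _   = tt
  after⇒earlier (just _) s<t t<r = R-trans s<t t<r

  drop-until : TWalk R lab p u v vs → Unique vs → w ∈ₗ vs →
    ∃₂ λ q ws → Earlier R p q × TWalk R lab q w v ws × Unique ws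
  drop-until walk@(here _)       uq       (here refl) = _ , _ , (λ a → a) , walk , uq
  drop-until walk@(step _ _ _ _) uq       (here refl) = _ , _ , (λ a → a) , walk , uq
  drop-until {p = p} (step t e a w) (_ ∷ uq) (there w∈) with drop-until w uq w∈
  ... | q , ws , f , w′ , uq′ = q , ws , (λ b → after⇒earlier p a (f b)) , w′ , uq′

  shorten : TWalk R lab p u v vs → ∃ λ ws → TWalk R lab p u v ws × Unique ws
  shorten (here v) = _ , here v , [] ∷ []
  shorten {p = p} {u = u} (step t e a w) with shorten w
  ... | ws , w′ , uq with any? (u ≟_) ws
  ...   | no u∉  = _ , step t e a w′ , ¬Any⇒All¬ ws u∉ ∷ uq
  ...   | yes u∈ with drop-until w′ uq u∈
  ...     | _ , ws′ , f , w″ , uq′ = ws′ , retime (λ b → after⇒earlier p a (f b)) w″ , uq′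

  walk⇒path : TWalk R lab nothing u v vs → TPathIn R lab ⊤ u v
  walk⇒path walk with shorten walk
  ... | ws , w , uq = ws , w , uq , All.universal (λ _ → ∈⊤) ws

StrictlyConnectedIn : TLabel k → Subset k → Set
StrictlyConnectedIn {k} lab S = ∀ {u v : Fin k} → u ∈ S → v ∈ S → u ≢ v →
  ∃ λ vs → TWalk _<_ lab nothing u v vs × All (_∈ S) vs

tcc⇒strictly-connected : ClosedTCC _<_ lab S → StrictlyConnectedIn lab S
tcc⇒strictly-connected tcc u∈ v∈ u≢v with tcc _ _ u∈ v∈ u≢v
... | vs , walk , _ , vs⊆S = vs , walk , vs⊆S

module _ (proper : ProperDirected lab) where

  EnteredAt : Maybe ℕ → Fin _ → Set
  EnteredAt nothing  _ = Data.Unit.⊤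
  EnteredAt (just s) u = ∃ λ x → lab x u ≡ just s

  strictify : TWalk _≤_ lab p u v vs → EnteredAt p u → TWalk _<_ lab p u v vs
  strictify (here v) _ = here v
  strictify {p = nothing} (step t e _ w) _ = step t e tt (strictify w (_ , e))
  strictify {p = just s} (step t e s≤t w) (x , e′) =
    step t e (≤∧≢⇒< s≤t λ { refl → proper x _ _ s e′ e }) (strictify w (_ , e))

  proper-tcc⇒strictly-connected : ClosedTCC _≤_ lab S → StrictlyConnectedIn lab S
  proper-tcc⇒strictly-connected tcc u∈ v∈ u≢v with tcc _ _ u∈ v∈ u≢v
  ... | vs , walk , _ , vs⊆S = vs , strictify walk tt , vs⊆S

element : (S : Subset k) → 1 ≤ ∣ S ∣ → Nonempty S
element (inside  ∷ S) _ = zero , here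
element (outside ∷ S) h with element S h
... | x , x∈ = suc x , there x∈

other : (S : Subset k) → 2 ≤ ∣ S ∣ → ∀ x → ∃ λ y → y ∈ S × y ≢ x
other (inside ∷ S) (s≤s h) zero with element S h
... | y , y∈ = suc y , there y∈ , λ ()
other (inside  ∷ S) _ (suc x) = zero , here , λ ()
other (outside ∷ S) h zero with element S (<⇒≤ h)
... | y , y∈ = suc y , there y∈ , λ ()
other (outside ∷ S) h (suc x) with other S h x
... | y , y∈ , y≢x = suc y , there y∈ , λ eq → y≢x (suc-injective eq)

two-others : (S : Subset k) → 3 ≤ ∣ S ∣ → ∀ x →
  ∃₂ λ y z → y ∈ S × z ∈ S × y ≢ x × z ≢ x × y ≢ z
two-others (inside ∷ S) (s≤s h) zero with element S (<⇒≤ h)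
... | y , y∈ with other S h y
...   | z , z∈ , z≢y = suc y , suc z , there y∈ , there z∈ , (λ ()) , (λ ()) ,
                      λ eq → z≢y (suc-injective (sym eq))
two-others (inside ∷ S) (s≤s h) (suc x) with other S h x
... | z , z∈ , z≢x =
  zero , suc z , here , there z∈ , (λ ()) , (λ eq → z≢x (suc-injective eq)) , λ ()
two-others (outside ∷ S) h zero with element S (<⇒≤ (<⇒≤ h))
... | y , y∈ with other S (<⇒≤ h) y
...   | z , z∈ , z≢y = suc y , suc z , there y∈ , there z∈ , (λ ()) , (λ ()) ,
                      λ eq → z≢y (suc-injective (sym eq))
two-others (outside ∷ S) h (suc x) with two-others S h x
... | y , z , y∈ , z∈ , y≢x , z≢x , y≢z =
  suc y , suc z , there y∈ , there z∈ , (λ eq → y≢x (suc-injective eq)) ,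
  (λ eq → z≢x (suc-injective eq)) , λ eq → y≢z (suc-injective eq)

Dominates : TLabel k → Subset k → Fin k → Set
Dominates lab S h = ∀ {w} → w ∈ S → w ≢ h → Adjacent lab h w

TriangleFreeAt : TLabel k → Subset k → Fin k → Set
TriangleFreeAt lab S h = ∀ {w z} → w ∈ S → z ∈ S → Adjacent lab h w → Adjacent lab h z → ¬ Adjacent lab w z

module _ (lab-sym : Symmetric lab) (tcc : ClosedTCC _<_ lab S) {h : Fin k} (h∈S : h ∈ S)
  (dominates : Dominates lab S h) (no-triangle : TriangleFreeAt lab S h) where

  private
    edge-off-centre : ∀ {w z} → w ∈ S → z ∈ S → w ≢ h → z ≢ h → ¬ Adjacent lab w z
    edge-off-centre w∈ z∈ w≢h z≢h = no-triangle w∈ z∈ (dominates w∈ w≢h) (dominates z∈ z≢h)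

    from-centre : ∀ {z s vs} → z ≢ h →
      TWalk _<_ lab (just s) h z vs → Unique vs → All (_∈ S) vs → ∃ λ t → lab h z ≡ just t × s < t
    from-centre z≢h (here _) _ _ = ⊥-elim (z≢h refl)
    from-centre {z} z≢h (step {w = y} t e s<t rest) (h∉ ∷ _) (_ ∷ ys∈) with y ≟ z | rest
    ... | yes refl | _               = t , e , s<t
    ... | no y≢z   | here _          = ⊥-elim (y≢z refl)
    ... | no _     | step r e′ _ rest′ with h∉ | ys∈
    ...   | h≢y ∷ h∉′ | y∈ ∷ ys′∈ =
      ⊥-elim (edge-off-centre y∈ (all-head ys′∈ rest′) (λ eq → h≢y (sym eq))
                              (λ eq → all-head h∉′ rest′ (sym eq)) (r , e′))

    through-centre : ∀ {w z} → w ∈ S → z ∈ S → w ≢ h → z ≢ h → w ≢ z →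
      ∃₂ λ s t → lab w h ≡ just s × lab h z ≡ just t × s < t
    through-centre w∈ z∈ w≢h z≢h w≢z with tcc _ _ w∈ z∈ w≢z
    ... | _ , here _ , _ , _ = ⊥-elim (w≢z refl)
    ... | _ , step {w = y} s e _ rest , _ ∷ uq , _ ∷ ys∈ with y ≟ h
    ...   | no y≢h   = ⊥-elim (edge-off-centre w∈ (all-head ys∈ rest) w≢h y≢h (s , e))
    ...   | yes refl with from-centre z≢h rest uq ys∈
    ...     | t , e′ , s<t = s , t , e , e′ , s<t

  no-spanning-star : 3 ≤ ∣ S ∣ → ⊥
  no-spanning-star big with two-others S big h
  ... | w , z , w∈ , z∈ , w≢h , z≢h , w≢z
    with through-centre w∈ z∈ w≢h z≢h w≢z
       | through-centre z∈ w∈ z≢h w≢h (λ eq → w≢z (sym eq))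
  ... | s , t , wh , hz , s<t | s′ , t′ , zh , hw , s′<t′ =
    <-asym s<t (subst₂ _<_ (just-injective (trans (sym zh) (trans (lab-sym z h) hz)))
                            (just-injective (trans (sym hw) (trans (lab-sym h w) wh))) s′<t′)

module _ (conn : StrictlyConnectedIn lab S) {h : Fin k} (h∈S : h ∈ S) where

  direct-arc-from :
    (∀ {y z s t} → lab h y ≡ just s → y ∈ S → lab y z ≡ just t → s < t → z ∉ S) →
    w ∈ S → w ≢ h → Adjacent lab h w
  direct-arc-from {w = w} no-detour w∈ w≢h with conn h∈S w∈ (λ eq → w≢h (sym eq))
  ... | _ , here _ , _ = ⊥-elim (w≢h refl)
  ... | _ , step {w = y} s e _ rest , _ ∷ ys∈ with y ≟ w
  ...   | yes refl = s , e
  ...   | no y≢w with rest | ys∈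
  ...     | here _ | _ = ⊥-elim (y≢w refl)
  ...     | step t e′ s<t rest′ | y∈ ∷ zs∈ =
    ⊥-elim (no-detour e y∈ e′ s<t (all-head zs∈ rest′))

  direct-arc-into :
    (∀ {x y s t} → lab x y ≡ just s → lab y h ≡ just t → y ∈ S → s < t → x ∉ S) →
    w ∈ S → w ≢ h → Adjacent lab w h
  direct-arc-into no-detour w∈ w≢h with conn w∈ h∈S w≢h
  ... | _ , walk , vs⊆S with arcs-into-end walk w≢h
  ...   | inj₁ (t , e , _) = t , e
  ...   | inj₂ (_ , _ , _ , _ , e , e′ , s<t , x∈ , y∈) =
    ⊥-elim (no-detour e e′ (All.lookup vs⊆S y∈) s<t (All.lookup vs⊆S x∈))

module Encoded {V : Set} {k : ℕ} (enc : V → Fin k) (dec : Fin k → V)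
  (dec-enc : ∀ x → dec (enc x) ≡ x) (enc-dec : ∀ u → enc (dec u) ≡ u)
  (labV : V → V → Maybe ℕ) (Arc : V → V → ℕ → Set)
  (arc-sound : ∀ {x y t} → labV x y ≡ just t → Arc x y t)
  (arc-complete : ∀ {x y t} → Arc x y t → labV x y ≡ just t) where

  variable
    x y z : V

  labelling : TLabel k
  labelling u w = labV (dec u) (dec w)

  Adjacentᵥ : V → V → Set
  Adjacentᵥ x y = ∃ (Arc x y)

  arc⇒lab : Arc x y t → labelling (enc x) (enc y) ≡ just t
  arc⇒lab {x} {y} a rewrite dec-enc x | dec-enc y = arc-complete a

  arc⇒lab-from : Arc x (dec w) t → labelling (enc x) w ≡ just t
  arc⇒lab-from {x} {w} a = subst (λ x′ → labV x′ (dec w) ≡ just _) (sym (dec-enc x)) (arc-complete a)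

  lab⇒arc-from : labelling (enc x) w ≡ just t → Arc x (dec w) t
  lab⇒arc-from {x} e = subst (λ x′ → Arc x′ _ _) (dec-enc x) (arc-sound e)

  lab⇒arc-into : labelling w (enc y) ≡ just t → Arc (dec w) y t
  lab⇒arc-into {y = y} e = subst (λ y′ → Arc _ y′ _) (dec-enc y) (arc-sound e)

  lab⇒arc : labelling (enc x) (enc y) ≡ just t → Arc x y t
  lab⇒arc {x} {y} e = subst (λ y′ → Arc x y′ _) (dec-enc y) (lab⇒arc-from e)

  enc-≢ : x ≢ y → enc x ≢ enc y
  enc-≢ {x} {y} x≢y eq = x≢y (trans (sym (dec-enc x)) (trans (cong dec eq) (dec-enc y)))

  dec-≢ : u ≢ enc x → dec u ≢ x
  dec-≢ {u} u≢x eq = u≢x (trans (sym (enc-dec u)) (cong enc eq))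

  loopless : (∀ {x t} → ¬ Arc x x t) → Loopless labelling
  loopless irreflexive u with labV (dec u) (dec u) in e
  ... | nothing = refl
  ... | just _  = ⊥-elim (irreflexive (arc-sound e))

  proper : (∀ {x y z t} → Arc x y t → Arc y z t → ⊥) → ProperDirected labelling
  proper no-relay _ _ _ _ e e′ = no-relay (arc-sound e) (arc-sound e′)

  lifetime : ∀ {L} → (∀ {x y t} → Arc x y t → t ≤ L) → LifetimeAtMost L labelling
  lifetime bounded _ _ _ e = bounded (arc-sound e)

  data Route (R : ℕ → ℕ → Set) (p : Maybe ℕ) (x y : V) : Set where
    route : TWalk R labelling p (enc x) (enc y) vs → Route R p x y

  stop : Route R p x x
  stop = route (here _)

  via : Arc x y t → After R p t → Route R (just t) y z → Route R p x z
  via a r (route walk) = route (step _ (arc⇒lab a) r walk)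

  from-start : Route R p x y → Route R nothing x y
  from-start (route walk) = route (retime (λ _ → tt) walk)

  temporally-connected : Transitive R → (∀ x y → x ≢ y → Route R nothing x y) →
    TemporallyConnected R labelling
  temporally-connected {R = R} R-trans routes u v u≢v with routes (dec u) (dec v) (u≢v ∘ dec-injective)
    where
    dec-injective : dec u ≡ dec v → u ≡ v
    dec-injective eq = trans (sym (enc-dec u)) (trans (cong enc eq) (enc-dec v))
  ... | route walk = subst₂ (TPathIn R labelling ⊤) (enc-dec u) (enc-dec v) (walk⇒path R-trans walk)

  infix 4 _∈ᵥ_ _∈ᵥ?_

  data _∈ᵥ_ (x : V) (S : Subset k) : Set where
    enc-∈ : enc x ∈ S → x ∈ᵥ S

  _∈ᵥ?_ : ∀ x (S : Subset k) → Dec (x ∈ᵥ S)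
  x ∈ᵥ? S = map′ enc-∈ (λ { (enc-∈ x∈) → x∈ }) (enc x ∈? S)

  ∈-dec : u ∈ S → dec u ∈ᵥ S
  ∈-dec {u} {S = S} u∈ = enc-∈ (subst (_∈ S) (sym (enc-dec u)) u∈)

  all-in : (∀ x → x ∈ᵥ S) → ∀ u → u ∈ S
  all-in {S = S} all u with all (dec u)
  ... | enc-∈ u∈ = subst (_∈ S) (enc-dec u) u∈

  elementᵥ : 1 ≤ ∣ S ∣ → ∃ (_∈ᵥ S)
  elementᵥ {S = S} big with element S big
  ... | u , u∈ = dec u , ∈-dec u∈

  otherᵥ : 2 ≤ ∣ S ∣ → ∀ x → ∃ λ y → y ∈ᵥ S × y ≢ x
  otherᵥ {S = S} big x with other S big (enc x)
  ... | u , u∈ , u≢x = dec u , ∈-dec u∈ , dec-≢ u≢x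

  pairᵥ : 2 ≤ ∣ S ∣ → ∃₂ λ x y → x ∈ᵥ S × y ∈ᵥ S × x ≢ y
  pairᵥ big with elementᵥ (<⇒≤ big)
  ... | x , x∈ with otherᵥ big x
  ...   | y , y∈ , y≢x = x , y , x∈ , y∈ , λ eq → y≢x (sym eq)

  -- Inv x p: a walk may stand at x, having arrived at time p (p = nothing before its first arc).
  record Closed (Inv : V → Maybe ℕ → Set) (Cut : V → Set) : Set where
    field
      closed : ∀ {x p y t} → Inv x p → Arc x y t → After _<_ p t → Cut y ⊎ Inv y (just t)

  module Forcing {S : Subset k} (conn : StrictlyConnectedIn labelling S) where

    invariant-or-cutᵥ : {Inv : V → Maybe ℕ → Set} {Cut : V → Set} → Closed Inv Cut →
      Inv x nothing → x ∈ᵥ S → y ∈ᵥ S → x ≢ y → (∃ λ c → Cut c × c ∈ᵥ S) ⊎ ∃ (Inv y)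
    invariant-or-cutᵥ {x} {y} {Inv} closed start (enc-∈ x∈) (enc-∈ y∈) x≢y
      with conn x∈ y∈ (enc-≢ x≢y)
    ... | _ , walk , vs⊆S
      with invariant-or-cut (λ {_} {p} i e a → Closed.closed closed {p = p} i (arc-sound e) a) walk
                            (subst (λ x′ → Inv x′ nothing) (sym (dec-enc x)) start)
    ...   | inj₁ cut     = let c∈ , c-cut = All.lookupAny vs⊆S cut in inj₁ (_ , c-cut , ∈-dec c∈)
    ...   | inj₂ (q , i) = inj₂ (q , subst (λ y′ → Inv y′ q) (dec-enc y) i)

    passes : {Inv : V → Maybe ℕ → Set} {Cut : V → Set} → Closed Inv Cut →
      Inv x nothing → (∀ q → ¬ Inv y q) → x ∈ᵥ S → y ∈ᵥ S → ∃ λ c → Cut c × c ∈ᵥ S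
    passes closed start never x∈ y∈
      with invariant-or-cutᵥ closed start x∈ y∈ (λ { refl → never nothing start })
    ... | inj₁ c       = c
    ... | inj₂ (q , i) = ⊥-elim (never q i)

    passes-through : {Inv : V → Maybe ℕ → Set} → Closed Inv (_≡ z) →
      Inv x nothing → (∀ q → ¬ Inv y q) → x ∈ᵥ S → y ∈ᵥ S → z ∈ᵥ S
    passes-through closed start never x∈ y∈ with passes closed start never x∈ y∈
    ... | _ , refl , z∈ = z∈

    out-neighbour : x ∈ᵥ S → y ∈ᵥ S → x ≢ y → ∃₂ λ z t → Arc x z t × z ∈ᵥ S
    out-neighbour {x} x∈ y∈ x≢y
      with passes first-arc (refl , refl) (λ { _ (refl , _) → x≢y refl }) x∈ y∈
      where
      first-arc : Closed (λ x′ p → x′ ≡ x × p ≡ nothing) (λ z → Adjacentᵥ x z)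
      first-arc .Closed.closed (refl , refl) a _ = inj₁ (_ , a)
    ... | z , (t , a) , z∈ = z , t , a , z∈

    in-neighbour : x ∈ᵥ S → y ∈ᵥ S → x ≢ y → ∃₂ λ w t → Arc w y t × w ∈ᵥ S
    in-neighbour (enc-∈ x∈) (enc-∈ y∈) x≢y with conn x∈ y∈ (enc-≢ x≢y)
    ... | _ , walk , vs⊆S with arc-into-end walk (enc-≢ x≢y)
    ...   | _ , t , e , w∈ = _ , t , lab⇒arc-into e , ∈-dec (All.lookup vs⊆S w∈)

  module Stars {S : Subset k} (tcc : ClosedTCC _<_ labelling S) where

    Dominatesᵥ : V → Set
    Dominatesᵥ x = ∀ {y} → y ∈ᵥ S → y ≢ x → Adjacentᵥ x y

    TriangleFreeAtᵥ : V → Set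
    TriangleFreeAtᵥ x = ∀ {y z} → y ∈ᵥ S → z ∈ᵥ S → Adjacentᵥ x y → Adjacentᵥ x z → ¬ Adjacentᵥ y z

    private
      conn : StrictlyConnectedIn labelling S
      conn = tcc⇒strictly-connected tcc

    direct-arc-fromᵥ : x ∈ᵥ S →
      (∀ {y z s t} → Arc x y s → y ∈ᵥ S → Arc y z t → s < t → ¬ z ∈ᵥ S) → Dominatesᵥ x
    direct-arc-fromᵥ (enc-∈ x∈) no-detour (enc-∈ y∈) y≢x
      with direct-arc-from conn x∈
             (λ e y′∈ e′ s<t z∈ →
                no-detour (lab⇒arc-from e) (∈-dec y′∈) (arc-sound e′) s<t (∈-dec z∈))
             y∈ (enc-≢ y≢x)
    ... | t , e = t , lab⇒arc e

    direct-arc-intoᵥ : x ∈ᵥ S →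
      (∀ {y z s t} → Arc z y s → Arc y x t → y ∈ᵥ S → s < t → ¬ z ∈ᵥ S) →
      y ∈ᵥ S → y ≢ x → Adjacentᵥ y x
    direct-arc-intoᵥ (enc-∈ x∈) no-detour (enc-∈ y∈) y≢x
      with direct-arc-into conn x∈
             (λ e e′ y′∈ s<t z∈ →
                no-detour (arc-sound e) (lab⇒arc-into e′) (∈-dec y′∈) s<t (∈-dec z∈))
             y∈ (enc-≢ y≢x)
    ... | t , e = t , lab⇒arc e

    triangle-free : (∀ {y z s t r} → Arc x y s → Arc x z t → ¬ Arc y z r) → TriangleFreeAtᵥ x
    triangle-free no-triangle _ _ (_ , a) (_ , a′) (_ , a″) = no-triangle a a′ a″

    no-spanning-starᵥ : Symmetric labelling → 3 ≤ ∣ S ∣ → x ∈ᵥ S → Dominatesᵥ x → TriangleFreeAtᵥ x → ⊥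
    no-spanning-starᵥ {x} lab-sym big (enc-∈ x∈) dominates no-triangle =
      no-spanning-star lab-sym tcc x∈ dominates′ no-triangle′ big
      where
      dominates′ : Dominates labelling S (enc x)
      dominates′ w∈ w≢x with dominates (∈-dec w∈) (dec-≢ w≢x)
      ... | t , a = t , arc⇒lab-from a
      no-triangle′ : TriangleFreeAt labelling S (enc x)
      no-triangle′ w∈ z∈ (s , e) (s′ , e′) (r , e″) =
        no-triangle (∈-dec w∈) (∈-dec z∈) (s , lab⇒arc-from e) (s′ , lab⇒arc-from e′)
                    (r , arc-sound e″)

-- The directed construction

module Directed (m′ : ℕ) where

  m : ℕ
  m = 3 + m′

  data V : Set where
    hub gate fan : Parity → V
    leaf         : (n : ℕ) → .(n < m) → V

  other-parity : ∀ {π σ} → σ ≢ π → σ ≡ π ⁻¹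
  other-parity {0ℙ} {0ℙ} σ≢π = ⊥-elim (σ≢π refl)
  other-parity {0ℙ} {1ℙ} _   = refl
  other-parity {1ℙ} {0ℙ} _   = refl
  other-parity {1ℙ} {1ℙ} σ≢π = ⊥-elim (σ≢π refl)

  π⁻¹≢π : ∀ {π} → π ⁻¹ ≢ π
  π⁻¹≢π {0ℙ} ()
  π⁻¹≢π {1ℙ} ()

  parity-suc≢ : ∀ n → parity (suc n) ≢ parity n
  parity-suc≢ n eq = π⁻¹≢π (trans (⁻¹-selfInverse (suc-homo-⁻¹ n)) eq)

  stepLabel : Parity → ℕ
  stepLabel 0ℙ = 3
  stepLabel 1ℙ = 4

  stepLabel-injective : ∀ {π σ} → stepLabel π ≡ stepLabel σ → π ≡ σ
  stepLabel-injective {0ℙ} {0ℙ} _ = refl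
  stepLabel-injective {1ℙ} {1ℙ} _ = refl

  2<stepLabel : ∀ π → 2 < stepLabel π
  2<stepLabel 0ℙ = ≤-lit
  2<stepLabel 1ℙ = ≤-lit

  stepLabel<5 : ∀ π → stepLabel π < 5
  stepLabel<5 0ℙ = ≤-lit
  stepLabel<5 1ℙ = ≤-lit

  data Arc : V → V → ℕ → Set where
    hub→gate   : ∀ {π}          → Arc (hub π) (gate π) 1
    hub→gate⁻¹ : ∀ {π σ}        → σ ≡ π ⁻¹ → Arc (hub π) (gate σ) 6
    hub→fan    : ∀ {π}          → Arc (hub π) (fan π) 6
    fan→gate   : ∀ {π}          → Arc (fan π) (gate π) 1
    fan→leaf   : ∀ {π n} .{p}   → parity n ≡ π → Arc (fan π) (leaf n p) 7
    gate→leaf  : ∀ {π} .{p}     → Arc (gate π) (leaf 0 p) 2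
    leaf→leaf  : ∀ {n t} .{p q} → t ≡ stepLabel (parity n) → Arc (leaf n p) (leaf (suc n) q) t
    leaf→hub   : ∀ {n π} .{p}   → π ≡ parity (suc n) ⊎ suc n ≡ m → Arc (leaf n p) (hub π) 5

  labV : V → V → Maybe ℕ
  labV (hub π)    (gate σ) with σ ℙ.≟ π
  ... | yes _ = just 1
  ... | no _  = just 6
  labV (hub π)    (fan σ)     = when (σ ℙ.≟ π) 6
  labV (fan π)    (gate σ)    = when (σ ℙ.≟ π) 1
  labV (fan π)    (leaf n _)  = when (parity n ℙ.≟ π) 7
  labV (gate _)   (leaf n _)  = when (n ℕ.≟ 0) 2
  labV (leaf n _) (leaf j _)  = when (j ℕ.≟ suc n) (stepLabel (parity n))
  labV (leaf n _) (hub π)     = when (π ℙ.≟ parity (suc n) ⊎-dec suc n ℕ.≟ m) 5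
  labV _          _           = nothing

  arc-sound : ∀ {x y t} → labV x y ≡ just t → Arc x y t
  arc-sound {hub π} {gate σ} e with σ ℙ.≟ π | e
  ... | yes refl | refl = hub→gate
  ... | no σ≢π   | refl = hub→gate⁻¹ (other-parity σ≢π)
  arc-sound {hub π} {fan σ} e with when-sound (σ ℙ.≟ π) e
  ... | refl , refl = hub→fan
  arc-sound {fan π} {gate σ} e with when-sound (σ ℙ.≟ π) e
  ... | refl , refl = fan→gate
  arc-sound {fan π} {leaf n _} e with when-sound (parity n ℙ.≟ π) e
  ... | eq , refl = fan→leaf eq
  arc-sound {gate _} {leaf n _} e with when-sound (n ℕ.≟ 0) e
  ... | refl , refl = gate→leaf
  arc-sound {leaf n _} {leaf j _} e with when-sound (j ℕ.≟ suc n) e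
  ... | refl , refl = leaf→leaf refl
  arc-sound {leaf n _} {hub π} e with when-sound (π ℙ.≟ parity (suc n) ⊎-dec suc n ℕ.≟ m) e
  ... | c , refl = leaf→hub c

  arc-complete : ∀ {x y t} → Arc x y t → labV x y ≡ just t
  arc-complete (hub→gate {0ℙ})        = refl
  arc-complete (hub→gate {1ℙ})        = refl
  arc-complete (hub→gate⁻¹ {0ℙ} refl) = refl
  arc-complete (hub→gate⁻¹ {1ℙ} refl) = refl
  arc-complete (hub→fan {π})          = when-complete (π ℙ.≟ π) refl
  arc-complete (fan→gate {π})         = when-complete (π ℙ.≟ π) refl
  arc-complete (fan→leaf {π} {n} eq)  = when-complete (parity n ℙ.≟ π) eq
  arc-complete gate→leaf              = refl
  arc-complete (leaf→leaf {n} refl)   = when-complete (suc n ℕ.≟ suc n) refl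
  arc-complete (leaf→hub {n} {π} c)   = when-complete (π ℙ.≟ parity (suc n) ⊎-dec suc n ℕ.≟ m) c

  arc-irreflexive : ∀ {x t} → ¬ Arc x x t
  arc-irreflexive ()

  arc-proper : ∀ {x y z t} → Arc x y t → Arc y z t → ⊥
  arc-proper (fan→leaf _)       (leaf→leaf eq)  = ≰-lit (subst (_< 5) (sym eq) (stepLabel<5 _))
  arc-proper gate→leaf          (leaf→leaf ())
  arc-proper (leaf→leaf eq)     (leaf→hub _)    = ≰-lit (subst (_< 5) (sym eq) (stepLabel<5 _))
  arc-proper (leaf→leaf {n} eq) (leaf→leaf eq′) =
    parity-suc≢ n (stepLabel-injective (trans (sym eq′) eq))

  leaf-out≤5 : ∀ {n y t} .{p} → Arc (leaf n p) y t → t ≤ 5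
  leaf-out≤5 {n} (leaf→leaf refl) = <⇒≤ (stepLabel<5 (parity n))
  leaf-out≤5 (leaf→hub _)         = ≤-refl

  arc-label≤7 : ∀ {x y t} → Arc x y t → t ≤ 7
  arc-label≤7 hub→gate          = ≤-lit
  arc-label≤7 (hub→gate⁻¹ _)    = ≤-lit
  arc-label≤7 hub→fan           = ≤-lit
  arc-label≤7 fan→gate          = ≤-lit
  arc-label≤7 (fan→leaf _)      = ≤-lit
  arc-label≤7 gate→leaf         = ≤-lit
  arc-label≤7 a@(leaf→leaf _)   = ≤-trans (leaf-out≤5 a) ≤-lit
  arc-label≤7 (leaf→hub _)      = ≤-lit

  order : ℕ
  order = 6 + m

  enc : V → Fin order
  enc (hub 0ℙ)   = 0F
  enc (hub 1ℙ)   = 1F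
  enc (gate 0ℙ)  = 2F
  enc (gate 1ℙ)  = 3F
  enc (fan 0ℙ)   = 4F
  enc (fan 1ℙ)   = 5F
  enc (leaf n p) = 6 ↑ʳ fromℕ< p

  dec : Fin order → V
  dec 0F = hub 0ℙ
  dec 1F = hub 1ℙ
  dec 2F = gate 0ℙ
  dec 3F = gate 1ℙ
  dec 4F = fan 0ℙ
  dec 5F = fan 1ℙ
  dec (suc (suc (suc (suc (suc (suc i)))))) = leaf (toℕ i) (toℕ<n i)

  leaf-cong : ∀ {n j} .{p q} → n ≡ j → leaf n p ≡ leaf j q
  leaf-cong refl = refl

  dec-enc : ∀ x → dec (enc x) ≡ x
  dec-enc (hub 0ℙ)   = refl
  dec-enc (hub 1ℙ)   = refl
  dec-enc (gate 0ℙ)  = refl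
  dec-enc (gate 1ℙ)  = refl
  dec-enc (fan 0ℙ)   = refl
  dec-enc (fan 1ℙ)   = refl
  dec-enc (leaf n p) = leaf-cong (toℕ-fromℕ< p)

  enc-dec : ∀ u → enc (dec u) ≡ u
  enc-dec 0F = refl
  enc-dec 1F = refl
  enc-dec 2F = refl
  enc-dec 3F = refl
  enc-dec 4F = refl
  enc-dec 5F = refl
  enc-dec (suc (suc (suc (suc (suc (suc i)))))) = cong (6 ↑ʳ_) (fromℕ<-toℕ i (toℕ<n i))

  open Encoded enc dec dec-enc enc-dec labV Arc arc-sound arc-complete public
  open Closed

  happy : Happy labelling
  happy = loopless arc-irreflexive , proper arc-proper

  lifetime≤7 : LifetimeAtMost 7 labelling
  lifetime≤7 = lifetime arc-label≤7

  leaf-to-hub : ∀ {n z} .{p} π → Route _≤_ (just 5) (hub π) z → Route _≤_ (just 2) (leaf n p) z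
  leaf-to-hub {n} π r with π ℙ.≟ parity (suc n)
  ... | yes π-next = via (leaf→hub (inj₁ π-next)) ≤-lit r
  leaf-to-hub {n} {p = p} π r | no π≢next with suc n ℕ.≟ m
  ... | yes last = via (leaf→hub (inj₂ last)) ≤-lit r
  ... | no not-last =
    via (leaf→leaf {q = ≤∧≢⇒< p not-last} refl) (<⇒≤ (2<stepLabel (parity n)))
        (via (leaf→hub (inj₁ π-next-next)) (<⇒≤ (stepLabel<5 (parity n))) r)
    where
    π-next-next : π ≡ parity (suc (suc n))
    π-next-next = trans (other-parity π≢next) (suc-homo-⁻¹ n)

  to-hub : ∀ x π {z} → Route _≤_ (just 5) (hub π) z → Route _≤_ nothing x z
  to-hub (hub σ)    π r = via hub→gate tt (via (gate→leaf {p = z<s}) ≤-lit (leaf-to-hub π r))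
  to-hub (gate σ)   π r = via (gate→leaf {p = z<s}) tt (leaf-to-hub π r)
  to-hub (fan σ)    π r = via fan→gate tt (via (gate→leaf {p = z<s}) ≤-lit (leaf-to-hub π r))
  to-hub (leaf n p) π r = from-start (leaf-to-hub π r)

  reach : ∀ x y → Route _≤_ nothing x y
  reach x (hub π)    = to-hub x π stop
  reach x (gate σ)   = to-hub x (σ ⁻¹) (via (hub→gate⁻¹ (sym (⁻¹-involutive σ))) ≤-lit stop)
  reach x (fan σ)    = to-hub x σ (via hub→fan ≤-lit stop)
  reach x (leaf n p) = to-hub x (parity n) (via hub→fan ≤-lit (via (fan→leaf refl) ≤-lit stop))

  connected : TemporallyConnected _≤_ labelling
  connected = temporally-connected ≤-trans (λ x y _ → reach x y)

  data LeafAt (n : ℕ) : V → Set where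
    leaf : ∀ .{p} → LeafAt n (leaf n p)

  IsLeaf : V → Set
  IsLeaf x = ∃ λ n → LeafAt n x

  data IsHub : V → Set where
    hub : ∀ {π} → IsHub (hub π)

  hub? : ∀ x → Dec (IsHub x)
  hub? (hub _)    = yes hub
  hub? (gate _)   = no λ ()
  hub? (fan _)    = no λ ()
  hub? (leaf _ _) = no λ ()

  rank : V → ℕ
  rank (hub _)    = 0
  rank (fan _)    = 0
  rank (gate _)   = 1
  rank (leaf n _) = 2 + n

  rank-increases : ∀ {x y t} → Arc x y t → ¬ IsHub x → ¬ IsHub y → rank x < rank y
  rank-increases hub→gate       ¬hub _    = ⊥-elim (¬hub hub)
  rank-increases (hub→gate⁻¹ _) ¬hub _    = ⊥-elim (¬hub hub)
  rank-increases hub→fan        ¬hub _    = ⊥-elim (¬hub hub)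
  rank-increases fan→gate       _    _    = ≤-lit
  rank-increases (fan→leaf _)   _    _    = z<s
  rank-increases gate→leaf      _    _    = ≤-lit
  rank-increases (leaf→leaf _)  _    _    = ≤-refl
  rank-increases (leaf→hub _)   _    ¬hub = ⊥-elim (¬hub hub)

  data Above (x₀ : V) : V → Maybe ℕ → Set where
    start : Above x₀ x₀ nothing
    above : ∀ {x q} → ¬ IsHub x → rank x₀ < rank x → Above x₀ x q

  above-closed : ∀ {x₀} → ¬ IsHub x₀ → Closed (Above x₀) IsHub
  above-closed ¬hub₀ .closed {y = y} state a _ with hub? y
  ... | yes hub-y = inj₁ hub-y
  above-closed ¬hub₀ .closed start          a _ | no ¬hub-y =
    inj₂ (above ¬hub-y (rank-increases a ¬hub₀ ¬hub-y))
  above-closed ¬hub₀ .closed (above ¬hub r) a _ | no ¬hub-y =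
    inj₂ (above ¬hub-y (<-trans r (rank-increases a ¬hub ¬hub-y)))

  data FromHub (π : Parity) : V → Maybe ℕ → Set where
    start  : FromHub π (hub π) nothing
    gate⁻¹ : ∀ {σ} → σ ≡ π ⁻¹ → FromHub π (gate σ) (just 6)

  from-hub : ∀ {π} → Closed (FromHub π) (λ y → y ≡ gate π ⊎ y ≡ fan π)
  from-hub .closed start      hub→gate       _   = inj₁ (inj₁ refl)
  from-hub .closed start      (hub→gate⁻¹ e) _   = inj₂ (gate⁻¹ e)
  from-hub .closed start      hub→fan        _   = inj₁ (inj₂ refl)
  from-hub .closed (gate⁻¹ _) gate→leaf      6<2 = ≰-lit 6<2

  data FromFan (π : Parity) : V → Maybe ℕ → Set where
    start : FromFan π (fan π) nothing
    leaf  : ∀ {n} .{p} → FromFan π (leaf n p) (just 7)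

  from-fan : ∀ {π} → Closed (FromFan π) (_≡ gate π)
  from-fan .closed start fan→gate     _   = inj₁ refl
  from-fan .closed start (fan→leaf _) _   = inj₂ leaf
  from-fan .closed leaf  a            7<t = ≰-lit (≤-trans 7<t (leaf-out≤5 a))

  data ToGate (π : Parity) : V → Maybe ℕ → Set where
    leaf   : ∀ {n q} .{p} → ToGate π (leaf n p) q
    hub    : ToGate π (hub π) (just 5)
    gate⁻¹ : ∀ {σ} → σ ≡ π ⁻¹ → ToGate π (gate σ) (just 6)
    fan    : ToGate π (fan π) (just 6)

  to-gate : ∀ {π} → Closed (ToGate π) (_≡ hub (π ⁻¹))
  to-gate .closed leaf (leaf→leaf _) _ = inj₂ leaf
  to-gate {π} .closed leaf (leaf→hub {π = σ} _) _ with σ ℙ.≟ π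
  ... | yes refl = inj₂ hub
  ... | no σ≢π   = inj₁ (cong hub (other-parity σ≢π))
  to-gate .closed hub        hub→gate       5<1 = ≰-lit 5<1
  to-gate .closed hub        (hub→gate⁻¹ e) _   = inj₂ (gate⁻¹ e)
  to-gate .closed hub        hub→fan        _   = inj₂ fan
  to-gate .closed (gate⁻¹ _) gate→leaf      6<2 = ≰-lit 6<2
  to-gate .closed fan        fan→gate       6<1 = ≰-lit 6<1
  to-gate .closed fan        (fan→leaf _)   _   = inj₂ leaf

  data FromLeaf (n : ℕ) : V → Maybe ℕ → Set where
    start : ∀ .{p} → FromLeaf n (leaf n p) nothing
    hub   : ∀ {π} → π ≡ parity (suc n) → FromLeaf n (hub π) (just 5)
    gate  : ∀ {π} → FromLeaf n (gate π) (just 6)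
    fan   : ∀ {π} → FromLeaf n (fan π) (just 6)
    leaf  : ∀ {j} .{p} → FromLeaf n (leaf j p) (just 7)

  from-leaf : ∀ {n} → suc n ≢ m → Closed (FromLeaf n) (LeafAt (suc n))
  from-leaf _        .closed start   (leaf→leaf _)          _   = inj₁ leaf
  from-leaf _        .closed start   (leaf→hub (inj₁ e))    _   = inj₂ (hub e)
  from-leaf not-last .closed start   (leaf→hub (inj₂ last)) _   = ⊥-elim (not-last last)
  from-leaf _        .closed (hub _) hub→gate               5<1 = ≰-lit 5<1
  from-leaf _        .closed (hub _) (hub→gate⁻¹ _)         _   = inj₂ gate
  from-leaf _        .closed (hub _) hub→fan                _   = inj₂ fan
  from-leaf _        .closed gate    gate→leaf              6<2 = ≰-lit 6<2
  from-leaf _        .closed fan     fan→gate               6<1 = ≰-lit 6<1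
  from-leaf _        .closed fan     (fan→leaf _)           _   = inj₂ leaf
  from-leaf _        .closed leaf    a                      7<t = ≰-lit (≤-trans 7<t (leaf-out≤5 a))

  data BackToLeaf (n : ℕ) : V → Maybe ℕ → Set where
    later : ∀ {j q} .{p} → n < j → BackToLeaf n (leaf j p) q
    hub   : ∀ {π} → BackToLeaf n (hub π) (just 5)
    gate  : ∀ {π} → BackToLeaf n (gate π) (just 6)
    fan   : ∀ {π} → π ≢ parity n → BackToLeaf n (fan π) (just 6)
    leaf  : ∀ {j} .{p} → parity j ≢ parity n → BackToLeaf n (leaf j p) (just 7)

  back-to-leaf : ∀ {n} → Closed (BackToLeaf n) (_≡ fan (parity n))
  back-to-leaf .closed (later n<j) (leaf→leaf _)  _   = inj₂ (later (<-trans n<j (n<1+n _)))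
  back-to-leaf .closed (later _)   (leaf→hub _)   _   = inj₂ hub
  back-to-leaf .closed hub         hub→gate       5<1 = ≰-lit 5<1
  back-to-leaf .closed hub         (hub→gate⁻¹ _) _   = inj₂ gate
  back-to-leaf {n} .closed hub (hub→fan {π}) _ with π ℙ.≟ parity n
  ... | yes refl = inj₁ refl
  ... | no π≢    = inj₂ (fan π≢)
  back-to-leaf .closed gate        gate→leaf      6<2 = ≰-lit 6<2
  back-to-leaf .closed (fan _)     fan→gate       6<1 = ≰-lit 6<1
  back-to-leaf .closed (fan π≢)    (fan→leaf e)   _   = inj₂ (leaf λ eq → π≢ (trans (sym e) eq))
  back-to-leaf .closed (leaf _)    a              7<t = ≰-lit (≤-trans 7<t (leaf-out≤5 a))

  module InClosedTCC {S : Subset order} (tcc : ClosedTCC _≤_ labelling S) where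

    open Forcing (proper-tcc⇒strictly-connected (proper arc-proper) tcc)

    -- rank grows along arcs between non-hubs, so two non-hubs cannot reach each other avoiding hubs
    some-hub∈ : 2 ≤ ∣ S ∣ → ∃ λ h → IsHub h × h ∈ᵥ S
    some-hub∈ big with pairᵥ big
    ... | x , y , x∈ , y∈ , x≢y with hub? x | hub? y
    ...   | yes hub-x | _         = x , hub-x , x∈
    ...   | no _      | yes hub-y = y , hub-y , y∈
    ...   | no ¬hub-x | no ¬hub-y
      with invariant-or-cutᵥ (above-closed ¬hub-x) start x∈ y∈ x≢y
         | invariant-or-cutᵥ (above-closed ¬hub-y) start y∈ x∈ (λ eq → x≢y (sym eq))
    ... | inj₁ h                 | _                      = h
    ... | inj₂ _                 | inj₁ h                 = h
    ... | inj₂ (_ , start)       | _                      = ⊥-elim (x≢y refl)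
    ... | inj₂ (_ , above _ _)   | inj₂ (_ , start)       = ⊥-elim (x≢y refl)
    ... | inj₂ (_ , above _ x<y) | inj₂ (_ , above _ y<x) = ⊥-elim (<-asym x<y y<x)

    some-leaf∈ : ∀ {π y} → hub π ∈ᵥ S → y ∈ᵥ S → y ≢ hub π → ∃ λ ℓ → IsLeaf ℓ × ℓ ∈ᵥ S
    some-leaf∈ h∈ y∈ y≢h with in-neighbour y∈ h∈ y≢h
    ... | ℓ , _ , leaf→hub _ , ℓ∈ = ℓ , (_ , leaf) , ℓ∈

    gate∈ : ∀ {π ℓ} → hub π ∈ᵥ S → IsLeaf ℓ → ℓ ∈ᵥ S → gate π ∈ᵥ S
    gate∈ h∈ (_ , leaf) ℓ∈ with passes from-hub start (λ { _ () }) h∈ ℓ∈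
    ... | _ , inj₁ refl , g∈ = g∈
    ... | _ , inj₂ refl , f∈ = passes-through from-fan start (λ { _ () }) f∈ h∈

    other-hub∈ : ∀ {π ℓ} → IsLeaf ℓ → ℓ ∈ᵥ S → gate π ∈ᵥ S → hub (π ⁻¹) ∈ᵥ S
    other-hub∈ (_ , leaf) ℓ∈ g∈ =
      passes-through to-gate leaf (λ { _ (gate⁻¹ e) → π⁻¹≢π (sym e) }) ℓ∈ g∈

    next-leaf∈ : ∀ {n} .{p q} → suc n ≢ m →
      hub (parity n) ∈ᵥ S → leaf n p ∈ᵥ S → leaf (suc n) q ∈ᵥ S
    next-leaf∈ {n} not-last h∈ ℓ∈
      with passes (from-leaf not-last) start (λ { _ (hub e) → parity-suc≢ n (sym e) }) ℓ∈ h∈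
    ... | _ , leaf , ℓ′∈ = ℓ′∈

    fan∈ : ∀ {n} .{p q} → leaf (suc n) p ∈ᵥ S → leaf n q ∈ᵥ S → fan (parity n) ∈ᵥ S
    fan∈ ℓ′∈ ℓ∈ = passes-through back-to-leaf (later (n<1+n _))
                    (λ { _ (later n<n) → <-irrefl refl n<n ; _ (leaf ne) → ne refl }) ℓ′∈ ℓ∈

    vertex∈ : 2 ≤ ∣ S ∣ → ∀ x → x ∈ᵥ S
    vertex∈ big with some-hub∈ big
    ... | hub σ , hub , h∈ with otherᵥ big (hub σ)
    ...   | y , y∈ , y≢h with some-leaf∈ h∈ y∈ y≢h
    ...     | ℓ , is-leaf , ℓ∈ = all-vertices
      where
      hubs : ∀ π → hub π ∈ᵥ S
      hubs π with π ℙ.≟ σ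
      ... | yes refl = h∈
      ... | no π≢σ   = subst (λ π → hub π ∈ᵥ S) (sym (other-parity π≢σ))
                             (other-hub∈ is-leaf ℓ∈ (gate∈ h∈ is-leaf ℓ∈))

      gates : ∀ π → gate π ∈ᵥ S
      gates π = gate∈ (hubs π) is-leaf ℓ∈

      leaves : ∀ n .{p} → leaf n p ∈ᵥ S
      leaves zero with out-neighbour (gates 0ℙ) (hubs 0ℙ) (λ ())
      ... | _ , _ , gate→leaf , ℓ₀∈ = ℓ₀∈
      leaves (suc n) {p} = next-leaf∈ (<⇒≢-irr p) (hubs (parity n)) (leaves n {<-trans (n<1+n n) p})

      all-vertices : ∀ x → x ∈ᵥ S
      all-vertices (hub π)    = hubs π
      all-vertices (gate π)   = gates π
      all-vertices (fan 0ℙ)   = fan∈ (leaves 1 {≤-lit}) (leaves 0 {≤-lit})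
      all-vertices (fan 1ℙ)   = fan∈ (leaves 2 {≤-lit}) (leaves 1 {≤-lit})
      all-vertices (leaf n _) = leaves n

  only-trivial : OnlyTrivialTCCs _≤_ 2 labelling
  only-trivial S big tcc = all-in (InClosedTCC.vertex∈ tcc big)

-- The undirected construction

module Undirected (m′ : ℕ) where

  m : ℕ
  m = 4 + m′

  next prev : Fin 3 → Fin 3
  next 0F = 1F
  next 1F = 2F
  next 2F = 0F
  prev 0F = 2F
  prev 1F = 0F
  prev 2F = 1F

  residue : ℕ → Fin 3
  residue zero    = 0F
  residue (suc n) = next (residue n)

  next-next : ∀ d → next (next d) ≡ prev d
  next-next 0F = refl
  next-next 1F = refl
  next-next 2F = refl

  prev-next : ∀ d → prev (next d) ≡ d
  prev-next 0F = refl
  prev-next 1F = refl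
  prev-next 2F = refl

  next≢ : ∀ d → next d ≢ d
  next≢ 0F ()
  next≢ 1F ()
  next≢ 2F ()

  prev≢ : ∀ d → prev d ≢ d
  prev≢ 0F ()
  prev≢ 1F ()
  prev≢ 2F ()

  prev≢next : ∀ d → prev d ≢ next d
  prev≢next 0F ()
  prev≢next 1F ()
  prev≢next 2F ()

  around : ∀ c e → e ≡ prev c ⊎ e ≡ c ⊎ e ≡ next c
  around 0F 0F = inj₂ (inj₁ refl)
  around 0F 1F = inj₂ (inj₂ refl)
  around 0F 2F = inj₁ refl
  around 1F 0F = inj₁ refl
  around 1F 1F = inj₂ (inj₁ refl)
  around 1F 2F = inj₂ (inj₂ refl)
  around 2F 0F = inj₂ (inj₂ refl)
  around 2F 1F = inj₁ refl
  around 2F 2F = inj₂ (inj₁ refl)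

  residue-toℕ : ∀ d → residue (toℕ d) ≡ d
  residue-toℕ 0F = refl
  residue-toℕ 1F = refl
  residue-toℕ 2F = refl

  data V : Set where
    root                              : V
    collector distributor link feeder : Fin 3 → V
    leaf                              : (n : ℕ) → .(n < m) → V

  leaf-cong : ∀ {n j} .{p q} → n ≡ j → leaf n p ≡ leaf j q
  leaf-cong refl = refl

  toℕ<m : (d : Fin 3) → toℕ d < m
  toℕ<m d = ≤-trans (toℕ<n d) ≤-lit

  leaf-of : Fin 3 → V
  leaf-of d = leaf (toℕ d) (toℕ<m d)

  distributor-injective : ∀ {d e} → _≡_ {A = V} (distributor d) (distributor e) → d ≡ e
  distributor-injective refl = refl

  collector-injective : ∀ {d e} → _≡_ {A = V} (collector d) (collector e) → d ≡ e
  collector-injective refl = refl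

  Collects : ℕ → Fin 3 → Set
  Collects n e = e ≡ prev (residue n) ⊎ (n ≡ 0 × e ≡ 1F) ⊎ (suc n ≡ m × e ≡ residue n)

  collects? : ∀ n e → Dec (Collects n e)
  collects? n e =
    e F.≟ prev (residue n) ⊎-dec (n ℕ.≟ 0 ×-dec e F.≟ 1F) ⊎-dec (suc n ℕ.≟ m ×-dec e F.≟ residue n)

  ¬collects-own-feeder : ∀ d → ¬ Collects (toℕ d) d
  ¬collects-own-feeder 0F (inj₁ ())
  ¬collects-own-feeder 0F (inj₂ (inj₁ (_ , ())))
  ¬collects-own-feeder 0F (inj₂ (inj₂ (() , _)))
  ¬collects-own-feeder 1F (inj₁ ())
  ¬collects-own-feeder 1F (inj₂ (inj₂ (() , _)))
  ¬collects-own-feeder 2F (inj₁ ())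
  ¬collects-own-feeder 2F (inj₂ (inj₂ (() , _)))

  collects-inner : ∀ {n e} → Collects n e → n ≢ 0 → suc n ≢ m → e ≡ prev (residue n)
  collects-inner (inj₁ usual)              _   _        = usual
  collects-inner (inj₂ (inj₁ (first , _))) n≢0 _        = ⊥-elim (n≢0 first)
  collects-inner (inj₂ (inj₂ (last , _)))  _   not-last = ⊥-elim (not-last last)

  ¬collects-both : ∀ {n e} → suc n ≢ m → Collects n e → Collects (suc n) e → ⊥
  ¬collects-both {n} _ (inj₁ refl) (inj₁ e≡)             =
    prev≢ (residue n) (trans e≡ (prev-next (residue n)))
  ¬collects-both {n} _ (inj₁ refl) (inj₂ (inj₂ (_ , e≡))) = prev≢next (residue n) e≡
  ¬collects-both _ (inj₂ (inj₁ (refl , refl))) (inj₁ ())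
  ¬collects-both _ (inj₂ (inj₁ (refl , refl))) (inj₂ (inj₂ (() , _)))
  ¬collects-both not-last (inj₂ (inj₂ (last , _))) _       = not-last last
  ¬collects-both _ _ (inj₂ (inj₁ (() , _)))

  data Edge : V → V → ℕ → Set where
    leaf–leaf           : ∀ {n} .{p q} → Edge (leaf n p) (leaf (suc n) q) 4
    leaf–collector      : ∀ {n e} .{p} → Collects n e → Edge (leaf n p) (collector e) 5
    leaf–distributor    : ∀ {n e} .{p} → e ≡ residue n → Edge (leaf n p) (distributor e) 8
    leaf–feeder         : ∀ {n e} .{p} → n ≡ toℕ e → Edge (leaf n p) (feeder e) 3
    root–collector      : ∀ {e}        → Edge root (collector e) 6
    root–distributor    : ∀ {e}        → Edge root (distributor e) 7
    link–distributor    : ∀ {d}        → Edge (link d) (distributor d) 0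
    link–distributor⁺   : ∀ {d e}      → e ≡ next d → Edge (link d) (distributor e) 8
    link–collector      : ∀ {d}        → Edge (link d) (collector d) 1
    feeder–collector    : ∀ {d}        → Edge (feeder d) (collector d) 2
    feeder–distributor⁺ : ∀ {d e}      → e ≡ next d → Edge (feeder d) (distributor e) 8

  edge : V → V → Maybe ℕ
  edge (leaf n _) (leaf j _)        = when (j ℕ.≟ suc n) 4
  edge (leaf n _) (collector e)     = when (collects? n e) 5
  edge (leaf n _) (distributor e)   = when (e F.≟ residue n) 8
  edge (leaf n _) (feeder e)        = when (n ℕ.≟ toℕ e) 3
  edge root       (collector _)     = just 6
  edge root       (distributor _)   = just 7
  edge (link d)   (distributor e) with e F.≟ d
  ... | yes _ = just 0
  ... | no _  = when (e F.≟ next d) 8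
  edge (link d)   (collector e)     = when (e F.≟ d) 1
  edge (feeder d) (collector e)     = when (e F.≟ d) 2
  edge (feeder d) (distributor e)   = when (e F.≟ next d) 8
  edge _          _                 = nothing

  edge-sound : ∀ {x y t} → edge x y ≡ just t → Edge x y t
  edge-sound {leaf n _} {leaf j _} e with when-sound (j ℕ.≟ suc n) e
  ... | refl , refl = leaf–leaf
  edge-sound {leaf n _} {collector c} e with when-sound (collects? n c) e
  ... | col , refl = leaf–collector col
  edge-sound {leaf n _} {distributor c} e with when-sound (c F.≟ residue n) e
  ... | eq , refl = leaf–distributor eq
  edge-sound {leaf n _} {feeder c} e with when-sound (n ℕ.≟ toℕ c) e
  ... | eq , refl = leaf–feeder eq
  edge-sound {root} {collector _} refl = root–collector
  edge-sound {root} {distributor _} refl = root–distributor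
  edge-sound {link d} {distributor c} e with c F.≟ d | e
  ... | yes refl | refl = link–distributor
  ... | no _     | e′ with when-sound (c F.≟ next d) e′
  ...   | eq , refl = link–distributor⁺ eq
  edge-sound {link d} {collector c} e with when-sound (c F.≟ d) e
  ... | refl , refl = link–collector
  edge-sound {feeder d} {collector c} e with when-sound (c F.≟ d) e
  ... | refl , refl = feeder–collector
  edge-sound {feeder d} {distributor c} e with when-sound (c F.≟ next d) e
  ... | eq , refl = feeder–distributor⁺ eq

  edge-complete : ∀ {x y t} → Edge x y t → edge x y ≡ just t
  edge-complete (leaf–leaf {n})                 = when-complete (suc n ℕ.≟ suc n) refl
  edge-complete (leaf–collector {n} {e} c)      = when-complete (collects? n e) c
  edge-complete (leaf–distributor {n} {e} eq)   = when-complete (e F.≟ residue n) eq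
  edge-complete (leaf–feeder {n} {e} eq)        = when-complete (n ℕ.≟ toℕ e) eq
  edge-complete root–collector                  = refl
  edge-complete root–distributor                = refl
  edge-complete (link–distributor {0F})         = refl
  edge-complete (link–distributor {1F})         = refl
  edge-complete (link–distributor {2F})         = refl
  edge-complete (link–distributor⁺ {0F} refl)   = refl
  edge-complete (link–distributor⁺ {1F} refl)   = refl
  edge-complete (link–distributor⁺ {2F} refl)   = refl
  edge-complete (link–collector {d})            = when-complete (d F.≟ d) refl
  edge-complete (feeder–collector {d})          = when-complete (d F.≟ d) refl
  edge-complete (feeder–distributor⁺ {d} {e} eq) = when-complete (e F.≟ next d) eq

  edge-antisymmetric : ∀ {x y s t} → Edge x y s → ¬ Edge y x t
  edge-antisymmetric leaf–leaf ()

  edge-label≤8 : ∀ {x y t} → Edge x y t → t ≤ 8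
  edge-label≤8 leaf–leaf                = ≤-lit
  edge-label≤8 (leaf–collector _)       = ≤-lit
  edge-label≤8 (leaf–distributor _)     = ≤-lit
  edge-label≤8 (leaf–feeder _)          = ≤-lit
  edge-label≤8 root–collector           = ≤-lit
  edge-label≤8 root–distributor         = ≤-lit
  edge-label≤8 link–distributor         = ≤-lit
  edge-label≤8 (link–distributor⁺ _)    = ≤-lit
  edge-label≤8 link–collector           = ≤-lit
  edge-label≤8 feeder–collector         = ≤-lit
  edge-label≤8 (feeder–distributor⁺ _)  = ≤-lit

  Arc : V → V → ℕ → Set
  Arc x y t = Edge x y t ⊎ Edge y x t

  labV : V → V → Maybe ℕ
  labV x y = edge x y <∣> edge y x

  labV-symmetric : ∀ x y → labV x y ≡ labV y x
  labV-symmetric x y with edge x y in exy | edge y x in eyx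
  ... | nothing | nothing = refl
  ... | nothing | just _  = refl
  ... | just _  | nothing = refl
  ... | just _  | just _  = ⊥-elim (edge-antisymmetric (edge-sound {x} {y} exy) (edge-sound {y} {x} eyx))

  arc-sound : ∀ {x y t} → labV x y ≡ just t → Arc x y t
  arc-sound {x} {y} e with edge x y in exy
  ... | just _  = inj₁ (edge-sound (trans exy e))
  ... | nothing = inj₂ (edge-sound e)

  arc-complete : ∀ {x y t} → Arc x y t → labV x y ≡ just t
  arc-complete {x} {y} (inj₁ e) rewrite edge-complete e = refl
  arc-complete {x} {y} (inj₂ e) with edge x y in exy
  ... | nothing = edge-complete e
  ... | just _  = ⊥-elim (edge-antisymmetric e (edge-sound exy))

  arc-irreflexive : ∀ {x t} → ¬ Arc x x t
  arc-irreflexive (inj₁ ())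
  arc-irreflexive (inj₂ ())

  arc-label≤8 : ∀ {x y t} → Arc x y t → t ≤ 8
  arc-label≤8 (inj₁ e) = edge-label≤8 e
  arc-label≤8 (inj₂ e) = edge-label≤8 e

  no-arc-after-8 : ∀ {A : Set} {x y t} → 8 < t → Arc x y t → A
  no-arc-after-8 8<t a = ≰-lit (≤-trans 8<t (arc-label≤8 a))

  order : ℕ
  order = 13 + m

  enc : V → Fin order
  enc root              = 0F
  enc (collector e)     = 1 ↑ʳ (e F.↑ˡ (9 + m))
  enc (distributor e)   = 4 ↑ʳ (e F.↑ˡ (6 + m))
  enc (link e)          = 7 ↑ʳ (e F.↑ˡ (3 + m))
  enc (feeder e)        = 10 ↑ʳ (e F.↑ˡ m)
  enc (leaf n p)        = 13 ↑ʳ fromℕ< p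

  pattern beyond-13 i = F.suc (F.suc (F.suc (F.suc (F.suc (F.suc (F.suc (F.suc (F.suc (F.suc (F.suc (F.suc (F.suc i))))))))))))

  dec : Fin order → V
  dec 0F                         = root
  dec 1F                         = collector 0F
  dec 2F                         = collector 1F
  dec 3F                         = collector 2F
  dec 4F                         = distributor 0F
  dec 5F                         = distributor 1F
  dec 6F                         = distributor 2F
  dec 7F                         = link 0F
  dec 8F                         = link 1F
  dec 9F                         = link 2F
  dec (F.suc 9F)                 = feeder 0F
  dec (F.suc (F.suc 9F))         = feeder 1F
  dec (F.suc (F.suc (F.suc 9F))) = feeder 2F
  dec (beyond-13 i)              = leaf (toℕ i) (toℕ<n i)

  dec-enc : ∀ x → dec (enc x) ≡ x
  dec-enc root              = refl
  dec-enc (collector 0F)    = refl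
  dec-enc (collector 1F)    = refl
  dec-enc (collector 2F)    = refl
  dec-enc (distributor 0F)  = refl
  dec-enc (distributor 1F)  = refl
  dec-enc (distributor 2F)  = refl
  dec-enc (link 0F)         = refl
  dec-enc (link 1F)         = refl
  dec-enc (link 2F)         = refl
  dec-enc (feeder 0F)       = refl
  dec-enc (feeder 1F)       = refl
  dec-enc (feeder 2F)       = refl
  dec-enc (leaf n p)        = leaf-cong (toℕ-fromℕ< p)

  enc-dec : ∀ u → enc (dec u) ≡ u
  enc-dec 0F                         = refl
  enc-dec 1F                         = refl
  enc-dec 2F                         = refl
  enc-dec 3F                         = refl
  enc-dec 4F                         = refl
  enc-dec 5F                         = refl
  enc-dec 6F                         = refl
  enc-dec 7F                         = refl
  enc-dec 8F                         = refl
  enc-dec 9F                         = refl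
  enc-dec (F.suc 9F)                 = refl
  enc-dec (F.suc (F.suc 9F))         = refl
  enc-dec (F.suc (F.suc (F.suc 9F))) = refl
  enc-dec (beyond-13 i)              = cong (13 ↑ʳ_) (fromℕ<-toℕ i (toℕ<n i))

  open Encoded enc dec dec-enc enc-dec labV Arc arc-sound arc-complete public
  open Closed

  no-loops : Loopless labelling
  no-loops = loopless arc-irreflexive

  symmetric : Symmetric labelling
  symmetric u w = labV-symmetric (dec u) (dec w)

  lifetime≤8 : LifetimeAtMost 8 labelling
  lifetime≤8 = lifetime arc-label≤8

  flip : ∀ {x y} → Adjacentᵥ y x → Adjacentᵥ x y
  flip (t , a) = t , swap a

  via-next-leaf : ∀ {n z} .{p} → suc n ≢ m →
    Route _<_ (just 5) (collector (residue n)) z → Route _<_ (just 3) (leaf n p) z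
  via-next-leaf {n} {p = p} not-last r =
    via (inj₁ (leaf–leaf {q = ≤∧≢⇒< p not-last})) ≤-lit
        (via (inj₁ (leaf–collector (inj₁ (sym (prev-next (residue n)))))) ≤-lit r)

  via-previous-leaf : ∀ {n z} .{p} → ¬ Collects n (next (residue n)) →
    Route _<_ (just 5) (collector (next (residue n))) z → Route _<_ (just 3) (leaf n p) z
  via-previous-leaf {zero}  ¬c _ = ⊥-elim (¬c (inj₂ (inj₁ (refl , refl))))
  via-previous-leaf {suc j} {p = p} _ r =
    via (inj₂ (leaf–leaf {q = p})) ≤-lit
        (via (inj₁ (leaf–collector {p = <-trans (n<1+n j) p} (inj₁ (next-next (residue j))))) ≤-lit r)

  leaf-to-collector : ∀ {n z} .{p} e →
    Route _<_ (just 5) (collector e) z → Route _<_ (just 3) (leaf n p) z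
  leaf-to-collector {n} e r with collects? n e | around (residue n) e
  ... | yes c  | _                 = via (inj₁ (leaf–collector c)) ≤-lit r
  ... | no ¬c  | inj₁ e≡prev       = ⊥-elim (¬c (inj₁ e≡prev))
  ... | no ¬c  | inj₂ (inj₂ refl)  = via-previous-leaf ¬c r
  ... | no ¬c  | inj₂ (inj₁ refl) with suc n ℕ.≟ m
  ...   | yes last    = ⊥-elim (¬c (inj₂ (inj₂ (last , refl))))
  ...   | no not-last = via-next-leaf not-last r

  to-root : ∀ x {z} → x ≢ root → Route _<_ (just 6) root z → Route _<_ nothing x z
  to-root root            root≢root _ = ⊥-elim (root≢root refl)
  to-root (collector e)   _ r = via (inj₂ root–collector) tt r
  to-root (leaf n p)      _ r = via (inj₁ (leaf–collector (inj₁ refl))) tt (via (inj₂ root–collector) ≤-lit r)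
  to-root (link e)        _ r = via (inj₁ link–collector) tt (via (inj₂ root–collector) ≤-lit r)
  to-root (feeder e)      _ r = via (inj₁ feeder–collector) tt (via (inj₂ root–collector) ≤-lit r)
  to-root (distributor e) _ r =
    via (inj₂ link–distributor) tt (via (inj₁ link–collector) ≤-lit (via (inj₂ root–collector) ≤-lit r))

  via-root : ∀ x {z} → (∀ {p} → After _<_ p 7 → Route _<_ p root z) → Route _<_ nothing x z
  via-root root              r = r tt
  via-root x@(leaf _ _)      r = to-root x (λ ()) (r ≤-lit)
  via-root x@(collector _)   r = to-root x (λ ()) (r ≤-lit)
  via-root x@(distributor _) r = to-root x (λ ()) (r ≤-lit)
  via-root x@(link _)        r = to-root x (λ ()) (r ≤-lit)
  via-root x@(feeder _)      r = to-root x (λ ()) (r ≤-lit)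

  feeder-to-collector : ∀ d e {p} → After _<_ p 3 → Route _<_ p (feeder d) (collector e)
  feeder-to-collector d e a = via (inj₂ (leaf–feeder {p = toℕ<m d} refl)) a (leaf-to-collector e stop)

  collector-to-collector : ∀ d e {p} → After _<_ p 2 → Route _<_ p (collector d) (collector e)
  collector-to-collector d e a = via (inj₂ feeder–collector) a (feeder-to-collector d e ≤-lit)

  link-to-collector : ∀ d e {p} → After _<_ p 1 → Route _<_ p (link d) (collector e)
  link-to-collector d e a = via (inj₁ link–collector) a (collector-to-collector d e ≤-lit)

  to-collector : ∀ x e → Route _<_ nothing x (collector e)
  to-collector root            e = via (inj₁ root–collector) tt stop
  to-collector (leaf n p)      e = from-start (leaf-to-collector e stop)
  to-collector (collector d)   e = collector-to-collector d e tt
  to-collector (distributor d) e = via (inj₂ link–distributor) tt (link-to-collector d e ≤-lit)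
  to-collector (link d)        e = link-to-collector d e tt
  to-collector (feeder d)      e = feeder-to-collector d e tt

  reach : ∀ x y → x ≢ y → Route _<_ nothing x y
  reach x root            x≢root = to-root x x≢root stop
  reach x (collector e)   _ = to-collector x e
  reach x (distributor d) _ = via-root x λ a → via (inj₁ root–distributor) a stop
  reach x (link d)        _ = via-root x λ a →
    via (inj₁ root–distributor) a (via (inj₂ (link–distributor⁺ refl)) ≤-lit stop)
  reach x (feeder d)      _ = via-root x λ a →
    via (inj₁ root–distributor) a (via (inj₂ (feeder–distributor⁺ refl)) ≤-lit stop)
  reach x (leaf n p)      _ = via-root x λ a →
    via (inj₁ root–distributor) a (via (inj₂ (leaf–distributor {p = p} refl)) ≤-lit stop)

  connected : TemporallyConnected _<_ labelling
  connected = temporally-connected <-trans reach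

  data IsLeaf : V → Set where
    leaf : ∀ {n} .{p} → IsLeaf (leaf n p)

  data LeafAt (n : ℕ) : V → Set where
    leaf : ∀ .{p} → LeafAt n (leaf n p)

  data Gadget : V → Set where
    distributor : ∀ {d} → Gadget (distributor d)
    link        : ∀ {d} → Gadget (link d)
    feeder      : ∀ {d} → Gadget (feeder d)

  -- Collector c can no longer be entered from these states: its arcs are labelled at most 6,
  -- and the one labelled 6 comes from the root.
  data Late (c : Fin 3) : V → Maybe ℕ → Set where
    collector   : ∀ {e} → e ≢ c → Late c (collector e) (just 5)
    leaf        : ∀ {n} .{p} → Late c (leaf n p) (just 5)
    root        : Late c root (just 6)
    distributor : ∀ {e} → Late c (distributor e) (just 7)
    dead        : ∀ {x} → x ≢ collector c → Late c x (just 8)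

  late-step : ∀ {c x p y t} → Late c x p → Arc x y t → After _<_ p t → Late c y (just t)
  late-step (collector _) (inj₂ (leaf–collector _))        5<5 = ≰-lit 5<5
  late-step (collector _) (inj₂ root–collector)            _   = root
  late-step (collector _) (inj₂ link–collector)            5<1 = ≰-lit 5<1
  late-step (collector _) (inj₂ feeder–collector)          5<2 = ≰-lit 5<2
  late-step leaf          (inj₁ leaf–leaf)                 5<4 = ≰-lit 5<4
  late-step leaf          (inj₂ leaf–leaf)                 5<4 = ≰-lit 5<4
  late-step leaf          (inj₁ (leaf–collector _))        5<5 = ≰-lit 5<5
  late-step leaf          (inj₁ (leaf–distributor _))      _   = dead λ ()
  late-step leaf          (inj₁ (leaf–feeder _))           5<3 = ≰-lit 5<3
  late-step root          (inj₁ root–collector)            6<6 = ≰-lit 6<6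
  late-step root          (inj₁ root–distributor)          _   = distributor
  late-step distributor   (inj₂ (leaf–distributor _))      _   = dead λ ()
  late-step distributor   (inj₂ root–distributor)          7<7 = ≰-lit 7<7
  late-step distributor   (inj₂ link–distributor)          ()
  late-step distributor   (inj₂ (link–distributor⁺ _))     _   = dead λ ()
  late-step distributor   (inj₂ (feeder–distributor⁺ _))   _   = dead λ ()
  late-step (dead _)      a                                8<t = no-arc-after-8 8<t a

  ¬late-target : ∀ {c q} → ¬ Late c (collector c) q
  ¬late-target (collector c≢c) = c≢c refl
  ¬late-target (dead ne)       = ne refl

  data FromDistributor (e : Fin 3) : V → Maybe ℕ → Set where
    start : FromDistributor e (distributor e) nothing
    link  : FromDistributor e (link e) (just 0)
    root  : FromDistributor e root (just 7)
    dead  : ∀ {x} → x ≢ distributor (prev e) → FromDistributor e x (just 8)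

  from-distributor : ∀ {e} → Closed (FromDistributor e) (_≡ collector e)
  from-distributor .closed start (inj₂ (leaf–distributor _))     _   = inj₂ (dead λ ())
  from-distributor .closed start (inj₂ root–distributor)         _   = inj₂ root
  from-distributor .closed start (inj₂ link–distributor)         _   = inj₂ link
  from-distributor .closed start (inj₂ (link–distributor⁺ _))    _   = inj₂ (dead λ ())
  from-distributor .closed start (inj₂ (feeder–distributor⁺ _))  _   = inj₂ (dead λ ())
  from-distributor .closed link  (inj₁ link–distributor)         ()
  from-distributor {e} .closed link (inj₁ (link–distributor⁺ refl)) _ =
    inj₂ (dead λ eq → prev≢next e (sym (distributor-injective eq)))
  from-distributor .closed link  (inj₁ link–collector)           _   = inj₁ refl
  from-distributor .closed root  (inj₁ root–collector)           7<6 = ≰-lit 7<6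
  from-distributor .closed root  (inj₁ root–distributor)         7<7 = ≰-lit 7<7
  from-distributor .closed (dead _) a 8<t = no-arc-after-8 8<t a

  ¬from-distributor : ∀ {e x q} → x ≡ distributor (prev e) → ¬ FromDistributor e x q
  ¬from-distributor {e} eq start = prev≢ e (sym (distributor-injective eq))
  ¬from-distributor eq (dead ne) = ne eq

  data FromCollector (d e : Fin 3) : V → Maybe ℕ → Set where
    start : FromCollector d e (collector d) nothing
    link  : FromCollector d e (link d) (just 1)
    late  : ∀ {x q} → Late e x q → FromCollector d e x q

  from-collector : ∀ {d e} → Closed (FromCollector d e) (_≡ feeder d)
  from-collector .closed start (inj₂ (leaf–collector _))   _   = inj₂ (late leaf)
  from-collector .closed start (inj₂ root–collector)       _   = inj₂ (late root)
  from-collector .closed start (inj₂ link–collector)       _   = inj₂ link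
  from-collector .closed start (inj₂ feeder–collector)     _   = inj₁ refl
  from-collector .closed link  (inj₁ link–distributor)     ()
  from-collector .closed link  (inj₁ (link–distributor⁺ _)) _  = inj₂ (late (dead λ ()))
  from-collector .closed link  (inj₁ link–collector)       1<1 = ≰-lit 1<1
  from-collector .closed (late l) a after = inj₂ (late (late-step l a after))

  ¬from-collector : ∀ {d e x q} → e ≢ d → x ≡ collector e → ¬ FromCollector d e x q
  ¬from-collector e≢d eq start    = e≢d (sym (collector-injective eq))
  ¬from-collector _   refl (late l) = ¬late-target l

  data FromFeeder (d e : Fin 3) : V → Maybe ℕ → Set where
    start     : FromFeeder d e (feeder d) nothing
    collector : FromFeeder d e (collector d) (just 2)
    late      : ∀ {x q} → Late e x q → FromFeeder d e x q

  from-feeder : ∀ {d e} → Closed (FromFeeder d e) (LeafAt (toℕ d))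
  from-feeder .closed start     (inj₂ (leaf–feeder refl))        _   = inj₁ leaf
  from-feeder .closed start     (inj₁ feeder–collector)          _   = inj₂ collector
  from-feeder .closed start     (inj₁ (feeder–distributor⁺ _))   _   = inj₂ (late (dead λ ()))
  from-feeder .closed collector (inj₂ (leaf–collector _))        _   = inj₂ (late leaf)
  from-feeder .closed collector (inj₂ root–collector)            _   = inj₂ (late root)
  from-feeder .closed collector (inj₂ link–collector)            2<1 = ≰-lit 2<1
  from-feeder .closed collector (inj₂ feeder–collector)          2<2 = ≰-lit 2<2
  from-feeder .closed (late l) a after = inj₂ (late (late-step l a after))

  ¬from-feeder : ∀ {d e x q} → e ≢ d → x ≡ collector e → ¬ FromFeeder d e x q
  ¬from-feeder e≢d eq collector = e≢d (sym (collector-injective eq))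
  ¬from-feeder _   refl (late l) = ¬late-target l

  data FromLeaf (n : ℕ) : V → Maybe ℕ → Set where
    start  : ∀ .{p} → FromLeaf n (leaf n p) nothing
    back   : ∀ {j} .{p} → suc j ≡ n → FromLeaf n (leaf j p) (just 4)
    feeder : ∀ {d} → FromLeaf n (feeder d) (just 3)
    late   : ∀ {x q} → Late (residue n) x q → FromLeaf n x q

  from-leaf : ∀ {n} → 2 ≤ n → .(suc n < m) → Closed (FromLeaf n) (LeafAt (suc n))
  from-leaf _ _ .closed start (inj₁ leaf–leaf)                   _   = inj₁ leaf
  from-leaf _ _ .closed start (inj₂ leaf–leaf)                   _   = inj₂ (back refl)
  from-leaf {n} (s≤s (s≤s _)) next<m .closed start (inj₁ (leaf–collector c)) _ =
    inj₂ (late (collector λ eq →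
      prev≢ (residue n) (trans (sym (collects-inner c (λ ()) (<⇒≢-irr next<m))) eq)))
  from-leaf _ _ .closed start (inj₁ (leaf–distributor _))        _   = inj₂ (late (dead λ ()))
  from-leaf _ _ .closed start (inj₁ (leaf–feeder _))             _   = inj₂ feeder
  from-leaf _ _ .closed (back _) (inj₁ leaf–leaf)                4<4 = ≰-lit 4<4
  from-leaf _ _ .closed (back _) (inj₂ leaf–leaf)                4<4 = ≰-lit 4<4
  from-leaf {suc j} (s≤s (s≤s _)) next<m .closed (back refl) (inj₁ (leaf–collector c)) _ =
    inj₂ (late (collector λ eq → prev≢next (residue j)
      (trans (sym (collects-inner c (λ ()) (<⇒≢-irr (<-trans (n<1+n (suc j)) next<m)))) eq)))
  from-leaf _ _ .closed (back _) (inj₁ (leaf–distributor _))     _   = inj₂ (late (dead λ ()))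
  from-leaf _ _ .closed (back _) (inj₁ (leaf–feeder _))          4<3 = ≰-lit 4<3
  from-leaf _ _ .closed feeder   (inj₁ feeder–collector)         3<2 = ≰-lit 3<2
  from-leaf _ _ .closed feeder   (inj₂ (leaf–feeder _))          3<3 = ≰-lit 3<3
  from-leaf _ _ .closed feeder   (inj₁ (feeder–distributor⁺ _))  _   = inj₂ (late (dead λ ()))
  from-leaf _ _ .closed (late l) a after = inj₂ (late (late-step l a after))

  data FromFirstLeaf : V → Maybe ℕ → Set where
    start     : ∀ .{p} → FromFirstLeaf (leaf 0 p) nothing
    second    : ∀ .{p} → FromFirstLeaf (leaf 1 p) (just 4)
    feeder    : ∀ {d} → FromFirstLeaf (feeder d) (just 3)
    collector : ∀ {e} → FromFirstLeaf (collector e) (just 5)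
    dead      : ∀ {x} → ¬ LeafAt 3 x → FromFirstLeaf x (just 8)

  from-first-leaf : Closed FromFirstLeaf (_≡ root)
  from-first-leaf .closed start     (inj₁ leaf–leaf)               _   = inj₂ second
  from-first-leaf .closed start     (inj₁ (leaf–collector _))      _   = inj₂ collector
  from-first-leaf .closed start     (inj₁ (leaf–distributor _))    _   = inj₂ (dead λ ())
  from-first-leaf .closed start     (inj₁ (leaf–feeder _))         _   = inj₂ feeder
  from-first-leaf .closed second    (inj₁ leaf–leaf)               4<4 = ≰-lit 4<4
  from-first-leaf .closed second    (inj₂ leaf–leaf)               4<4 = ≰-lit 4<4
  from-first-leaf .closed second    (inj₁ (leaf–collector _))      _   = inj₂ collector
  from-first-leaf .closed second    (inj₁ (leaf–distributor _))    _   = inj₂ (dead λ ())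
  from-first-leaf .closed second    (inj₁ (leaf–feeder _))         4<3 = ≰-lit 4<3
  from-first-leaf .closed feeder    (inj₁ feeder–collector)        3<2 = ≰-lit 3<2
  from-first-leaf .closed feeder    (inj₂ (leaf–feeder _))         3<3 = ≰-lit 3<3
  from-first-leaf .closed feeder    (inj₁ (feeder–distributor⁺ _)) _   = inj₂ (dead λ ())
  from-first-leaf .closed collector (inj₂ (leaf–collector _))      5<5 = ≰-lit 5<5
  from-first-leaf .closed collector (inj₂ root–collector)          _   = inj₁ refl
  from-first-leaf .closed collector (inj₂ link–collector)          5<1 = ≰-lit 5<1
  from-first-leaf .closed collector (inj₂ feeder–collector)        5<2 = ≰-lit 5<2
  from-first-leaf .closed (dead _)  a 8<t = no-arc-after-8 8<t a

  leaf-arc-label : ∀ {x y t} → IsLeaf x → IsLeaf y → Arc x y t → t ≡ 4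
  leaf-arc-label leaf leaf (inj₁ leaf–leaf) = refl
  leaf-arc-label leaf leaf (inj₂ leaf–leaf) = refl

  no-leaf-triangle : ∀ {x y z s t r} → IsLeaf x → IsLeaf y → IsLeaf z →
    Arc x y s → Arc x z t → ¬ Arc y z r
  no-leaf-triangle leaf leaf leaf (inj₁ leaf–leaf) (inj₁ leaf–leaf) (inj₁ ())
  no-leaf-triangle leaf leaf leaf (inj₁ leaf–leaf) (inj₁ leaf–leaf) (inj₂ ())
  no-leaf-triangle leaf leaf leaf (inj₁ leaf–leaf) (inj₂ leaf–leaf) (inj₁ ())
  no-leaf-triangle leaf leaf leaf (inj₁ leaf–leaf) (inj₂ leaf–leaf) (inj₂ ())
  no-leaf-triangle leaf leaf leaf (inj₂ leaf–leaf) (inj₁ leaf–leaf) (inj₁ ())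
  no-leaf-triangle leaf leaf leaf (inj₂ leaf–leaf) (inj₁ leaf–leaf) (inj₂ ())
  no-leaf-triangle leaf leaf leaf (inj₂ leaf–leaf) (inj₂ leaf–leaf) (inj₁ ())
  no-leaf-triangle leaf leaf leaf (inj₂ leaf–leaf) (inj₂ leaf–leaf) (inj₂ ())

  collector-detour : ∀ {e y z s t} →
    Arc (collector e) y s → ¬ Gadget y → Arc y z t → s < t → Gadget z
  collector-detour (inj₂ (leaf–collector _)) _ (inj₁ leaf–leaf)             5<4 = ≰-lit 5<4
  collector-detour (inj₂ (leaf–collector _)) _ (inj₂ leaf–leaf)             5<4 = ≰-lit 5<4
  collector-detour (inj₂ (leaf–collector _)) _ (inj₁ (leaf–collector _))    5<5 = ≰-lit 5<5
  collector-detour (inj₂ (leaf–collector _)) _ (inj₁ (leaf–distributor _))  _   = distributor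
  collector-detour (inj₂ (leaf–collector _)) _ (inj₁ (leaf–feeder _))       5<3 = ≰-lit 5<3
  collector-detour (inj₂ root–collector)     _ (inj₁ root–collector)        6<6 = ≰-lit 6<6
  collector-detour (inj₂ root–collector)     _ (inj₁ root–distributor)      _   = distributor
  collector-detour (inj₂ link–collector)     ¬gadget _ _ = ⊥-elim (¬gadget link)
  collector-detour (inj₂ feeder–collector)   ¬gadget _ _ = ⊥-elim (¬gadget feeder)

  collector-no-edge : ∀ {e y z s t r} → Arc (collector e) y s → Arc (collector e) z t →
    ¬ Gadget y → ¬ Gadget z → ¬ Edge y z r
  collector-no-edge (inj₂ link–collector)   _ ¬gadget _ _ = ¬gadget link
  collector-no-edge (inj₂ feeder–collector) _ ¬gadget _ _ = ¬gadget feeder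
  collector-no-edge _ (inj₂ link–collector)   _ ¬gadget _ = ¬gadget link
  collector-no-edge _ (inj₂ feeder–collector) _ ¬gadget _ = ¬gadget feeder
  collector-no-edge (inj₂ (leaf–collector c)) (inj₂ (leaf–collector c′)) _ _ (leaf–leaf {q = q}) =
    ¬collects-both (<⇒≢-irr q) c c′

  collector-no-triangle : ∀ {e y z s t r} → Arc (collector e) y s → Arc (collector e) z t →
    ¬ Gadget y → ¬ Gadget z → ¬ Arc y z r
  collector-no-triangle a a′ ¬g ¬g′ (inj₁ e) = collector-no-edge a a′ ¬g ¬g′ e
  collector-no-triangle a a′ ¬g ¬g′ (inj₂ e) = collector-no-edge a′ a ¬g′ ¬g e

  feeder-detour : ∀ {d y z s t} →
    Arc z y s → Arc y (feeder d) t → s < t → z ≡ link d ⊎ y ≡ distributor (next d)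
  feeder-detour _ (inj₂ (feeder–distributor⁺ refl)) _ = inj₂ refl
  feeder-detour (inj₁ link–collector)          (inj₂ feeder–collector) _   = inj₁ refl
  feeder-detour (inj₁ (leaf–collector _))      (inj₂ feeder–collector) 5<2 = ≰-lit 5<2
  feeder-detour (inj₁ root–collector)          (inj₂ feeder–collector) 6<2 = ≰-lit 6<2
  feeder-detour (inj₁ feeder–collector)        (inj₂ feeder–collector) 2<2 = ≰-lit 2<2
  feeder-detour (inj₁ leaf–leaf)               (inj₁ (leaf–feeder _))  4<3 = ≰-lit 4<3
  feeder-detour (inj₂ leaf–leaf)               (inj₁ (leaf–feeder _))  4<3 = ≰-lit 4<3
  feeder-detour (inj₂ (leaf–collector _))      (inj₁ (leaf–feeder _))  5<3 = ≰-lit 5<3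
  feeder-detour (inj₂ (leaf–distributor _))    (inj₁ (leaf–feeder _))  8<3 = ≰-lit 8<3
  feeder-detour (inj₂ (leaf–feeder _))         (inj₁ (leaf–feeder _))  3<3 = ≰-lit 3<3

  feeder-no-triangle : ∀ {d y z s t r} → Arc (feeder d) y s → Arc (feeder d) z t → ¬ Arc y z r
  feeder-no-triangle (inj₁ feeder–collector) (inj₁ feeder–collector) a = arc-irreflexive a
  feeder-no-triangle (inj₁ feeder–collector) (inj₁ (feeder–distributor⁺ _)) (inj₁ ())
  feeder-no-triangle (inj₁ feeder–collector) (inj₁ (feeder–distributor⁺ _)) (inj₂ ())
  feeder-no-triangle {d} (inj₁ feeder–collector) (inj₂ (leaf–feeder refl)) (inj₂ (leaf–collector c)) =
    ¬collects-own-feeder d c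
  feeder-no-triangle (inj₁ (feeder–distributor⁺ _)) (inj₁ feeder–collector) (inj₁ ())
  feeder-no-triangle (inj₁ (feeder–distributor⁺ _)) (inj₁ feeder–collector) (inj₂ ())
  feeder-no-triangle (inj₁ (feeder–distributor⁺ refl)) (inj₁ (feeder–distributor⁺ refl)) a = arc-irreflexive a
  feeder-no-triangle {d} (inj₁ (feeder–distributor⁺ refl)) (inj₂ (leaf–feeder refl)) (inj₂ (leaf–distributor eq)) =
    next≢ d (trans eq (residue-toℕ d))
  feeder-no-triangle {d} (inj₂ (leaf–feeder refl)) (inj₁ feeder–collector) (inj₁ (leaf–collector c)) =
    ¬collects-own-feeder d c
  feeder-no-triangle {d} (inj₂ (leaf–feeder refl)) (inj₁ (feeder–distributor⁺ refl)) (inj₁ (leaf–distributor eq)) =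
    next≢ d (trans eq (residue-toℕ d))
  feeder-no-triangle (inj₂ (leaf–feeder refl)) (inj₂ (leaf–feeder refl)) a = arc-irreflexive a

  distributor-detour : ∀ {d y z s t} → Arc (distributor d) y s → Arc y z t → s < t → y ≡ link d
  distributor-detour (inj₂ link–distributor)           _                        _   = refl
  distributor-detour (inj₂ (leaf–distributor _))      a 8<t = no-arc-after-8 8<t a
  distributor-detour (inj₂ (link–distributor⁺ _))     a 8<t = no-arc-after-8 8<t a
  distributor-detour (inj₂ (feeder–distributor⁺ _))   a 8<t = no-arc-after-8 8<t a
  distributor-detour (inj₂ root–distributor)  (inj₁ root–collector)   7<6 = ≰-lit 7<6
  distributor-detour (inj₂ root–distributor)  (inj₁ root–distributor) 7<7 = ≰-lit 7<7

  distributor-no-edge : ∀ {d y z s t r} → Arc (distributor d) y s → Arc (distributor d) z t → ¬ Edge y z r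
  distributor-no-edge {d} (inj₂ (leaf–distributor refl)) (inj₂ (leaf–distributor eq)) leaf–leaf =
    next≢ d (sym eq)
  distributor-no-edge {d} (inj₂ (leaf–distributor refl)) (inj₂ (feeder–distributor⁺ eq)) (leaf–feeder refl) =
    next≢ _ (trans (sym eq) (residue-toℕ _))

  distributor-no-triangle : ∀ {d y z s t r} → Arc (distributor d) y s → Arc (distributor d) z t → ¬ Arc y z r
  distributor-no-triangle a a′ (inj₁ e) = distributor-no-edge a a′ e
  distributor-no-triangle a a′ (inj₂ e) = distributor-no-edge a′ a e

  link-detour : ∀ {d y z s t} → Arc z y s → Arc y (link d) t → s < t → y ≡ distributor (next d)
  link-detour _ (inj₂ (link–distributor⁺ refl)) _ = refl
  link-detour _                             (inj₂ link–distributor) ()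
  link-detour (inj₁ (leaf–collector _))     (inj₂ link–collector)   5<1 = ≰-lit 5<1
  link-detour (inj₁ root–collector)         (inj₂ link–collector)   6<1 = ≰-lit 6<1
  link-detour (inj₁ link–collector)         (inj₂ link–collector)   1<1 = ≰-lit 1<1
  link-detour (inj₁ feeder–collector)       (inj₂ link–collector)   2<1 = ≰-lit 2<1

  link-no-edge : ∀ {d y z s t r} → Arc (link d) y s → Arc (link d) z t → ¬ Edge y z r
  link-no-edge (inj₁ link–collector) (inj₁ link–collector) ()

  link-no-triangle : ∀ {d y z s t r} → Arc (link d) y s → Arc (link d) z t → ¬ Arc y z r
  link-no-triangle a a′ (inj₁ e) = link-no-edge a a′ e
  link-no-triangle a a′ (inj₂ e) = link-no-edge a′ a e

  module InClosedTCC {S : Subset order} (tcc : ClosedTCC _<_ labelling S) (big : 3 ≤ ∣ S ∣) where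

    open Forcing (tcc⇒strictly-connected tcc)
    open Stars tcc

    star : ∀ {x} → x ∈ᵥ S → Dominatesᵥ x → TriangleFreeAtᵥ x → ⊥
    star = no-spanning-starᵥ symmetric big

    any-of : (f : Fin 3 → V) → (∃ λ d → f d ∈ᵥ S) ⊎ (∀ d → ¬ f d ∈ᵥ S)
    any-of f with f 0F ∈ᵥ? S | f 1F ∈ᵥ? S | f 2F ∈ᵥ? S
    ... | yes x∈ | _      | _      = inj₁ (0F , x∈)
    ... | no _   | yes x∈ | _      = inj₁ (1F , x∈)
    ... | no _   | no _   | yes x∈ = inj₁ (2F , x∈)
    ... | no ∉₀  | no ∉₁  | no ∉₂  = inj₂ λ { 0F → ∉₀ ; 1F → ∉₁ ; 2F → ∉₂ }

    ¬only-leaves : (∀ {x} → x ∈ᵥ S → IsLeaf x) → ⊥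
    ¬only-leaves only-leaves with elementᵥ (<⇒≤ (<⇒≤ big))
    ... | x , x∈ = star x∈ dominated no-triangle
      where
      dominated : Dominatesᵥ x
      dominated = direct-arc-fromᵥ x∈ λ a y∈ a′ s<t z∈ →
        <-irrefl (trans (leaf-arc-label (only-leaves x∈) (only-leaves y∈) a)
                        (sym (leaf-arc-label (only-leaves y∈) (only-leaves z∈) a′))) s<t
      no-triangle : TriangleFreeAtᵥ x
      no-triangle y∈ z∈ (_ , a) (_ , a′) (_ , a″) =
        no-leaf-triangle (only-leaves x∈) (only-leaves y∈) (only-leaves z∈) a a′ a″

    ¬gadget-free : (∀ {x} → Gadget x → ¬ x ∈ᵥ S) → ⊥
    ¬gadget-free free with any-of collector
    ... | inj₁ (e , c∈) = star c∈ dominated no-triangle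
      where
      dominated : Dominatesᵥ (collector e)
      dominated = direct-arc-fromᵥ c∈ λ a y∈ a′ s<t z∈ →
        free (collector-detour a (λ g → free g y∈) a′ s<t) z∈
      no-triangle : TriangleFreeAtᵥ (collector e)
      no-triangle y∈ z∈ (_ , a) (_ , a′) (_ , a″) =
        collector-no-triangle a a′ (λ g → free g y∈) (λ g → free g z∈) a″
    ... | inj₂ ∉collectors with root ∈ᵥ? S
    ...   | no ∉root = ¬only-leaves only-leaves
      where
      only-leaves : ∀ {x} → x ∈ᵥ S → IsLeaf x
      only-leaves {root}          r∈ = ⊥-elim (∉root r∈)
      only-leaves {collector e}   c∈ = ⊥-elim (∉collectors e c∈)
      only-leaves {distributor _} b∈ = ⊥-elim (free distributor b∈)
      only-leaves {link _}        l∈ = ⊥-elim (free link l∈)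
      only-leaves {feeder _}      f∈ = ⊥-elim (free feeder f∈)
      only-leaves {leaf _ _}      _  = leaf
    ...   | yes r∈ with otherᵥ (<⇒≤ big) root
    ...     | y , y∈ , y≢root with out-neighbour r∈ y∈ (λ eq → y≢root (sym eq))
    ...       | _ , _ , inj₁ root–collector   , c∈ = ∉collectors _ c∈
    ...       | _ , _ , inj₁ root–distributor , b∈ = free distributor b∈

    feeder⇒distributor-or-link : ∀ {d} → feeder d ∈ᵥ S → distributor (next d) ∈ᵥ S ⊎ link d ∈ᵥ S
    feeder⇒distributor-or-link {d} f∈ with distributor (next d) ∈ᵥ? S | link d ∈ᵥ? S
    ... | yes b∈ | _      = inj₁ b∈
    ... | no _   | yes l∈ = inj₂ l∈
    ... | no ∉b  | no ∉l  = ⊥-elim (star f∈ dominated (triangle-free feeder-no-triangle))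
      where
      dominated : Dominatesᵥ (feeder d)
      dominated y∈ y≢f = flip (direct-arc-intoᵥ f∈ no-detour y∈ y≢f)
        where
        no-detour : ∀ {y z s t} → Arc z y s → Arc y (feeder d) t → y ∈ᵥ S → s < t → ¬ z ∈ᵥ S
        no-detour a a′ y∈ s<t z∈ with feeder-detour a a′ s<t
        ... | inj₁ refl = ∉l z∈
        ... | inj₂ refl = ∉b y∈

    distributor⇒link : ∀ {d} → distributor d ∈ᵥ S → link d ∈ᵥ S
    distributor⇒link {d} b∈ with link d ∈ᵥ? S
    ... | yes l∈ = l∈
    ... | no ∉l  = ⊥-elim (star b∈ dominated (triangle-free distributor-no-triangle))
      where
      dominated : Dominatesᵥ (distributor d)
      dominated = direct-arc-fromᵥ b∈ λ a y∈ a′ s<t _ →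
        ∉l (subst (_∈ᵥ S) (distributor-detour a a′ s<t) y∈)

    link⇒distributor : ∀ {d} → link d ∈ᵥ S → distributor (next d) ∈ᵥ S
    link⇒distributor {d} l∈ with distributor (next d) ∈ᵥ? S
    ... | yes b∈ = b∈
    ... | no ∉b  = ⊥-elim (star l∈ dominated (triangle-free link-no-triangle))
      where
      dominated : Dominatesᵥ (link d)
      dominated y∈ y≢l = flip (direct-arc-intoᵥ l∈ (λ a a′ y∈ s<t _ →
        ∉b (subst (_∈ᵥ S) (link-detour a a′ s<t) y∈)) y∈ y≢l)

    some-distributor∈ : ∃ λ d → distributor d ∈ᵥ S
    some-distributor∈ with any-of distributor | any-of link | any-of feeder
    ... | inj₁ b | _ | _ = b
    ... | _ | inj₁ (d , l∈) | _ = next d , link⇒distributor l∈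
    ... | _ | _ | inj₁ (d , f∈) with feeder⇒distributor-or-link f∈
    ...   | inj₁ b∈ = next d , b∈
    ...   | inj₂ l∈ = next d , link⇒distributor l∈
    some-distributor∈ | inj₂ ∉b | inj₂ ∉l | inj₂ ∉f = ⊥-elim (¬gadget-free free)
      where
      free : ∀ {x} → Gadget x → ¬ x ∈ᵥ S
      free distributor = ∉b _
      free link        = ∉l _
      free feeder      = ∉f _

    distributor⇒next : ∀ {d} → distributor d ∈ᵥ S → distributor (next d) ∈ᵥ S
    distributor⇒next b∈ = link⇒distributor (distributor⇒link b∈)

    distributor∈ : ∀ e → distributor e ∈ᵥ S
    distributor∈ e with some-distributor∈
    ... | d , b∈ with around d e
    ...   | inj₁ refl        =
      subst (λ e → distributor e ∈ᵥ S) (next-next d) (distributor⇒next (distributor⇒next b∈))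
    ...   | inj₂ (inj₁ refl) = b∈
    ...   | inj₂ (inj₂ refl) = distributor⇒next b∈

    collector∈ : ∀ e → collector e ∈ᵥ S
    collector∈ e =
      passes-through from-distributor start (λ _ → ¬from-distributor refl) (distributor∈ e) (distributor∈ (prev e))

    feeder∈ : ∀ d → feeder d ∈ᵥ S
    feeder∈ d =
      passes-through from-collector start (λ _ → ¬from-collector (next≢ d) refl) (collector∈ d) (collector∈ (next d))

    leaf-of∈ : ∀ d → leaf-of d ∈ᵥ S
    leaf-of∈ d
      with passes from-feeder start (λ _ → ¬from-feeder (next≢ d) refl) (feeder∈ d) (collector∈ (next d))
    ... | _ , leaf , ℓ∈ = ℓ∈

    next-leaf∈ : ∀ {n} .{p q} → 2 ≤ n → leaf n p ∈ᵥ S → leaf (suc n) q ∈ᵥ S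
    next-leaf∈ {n} {q = q} 2≤n ℓ∈
      with passes (from-leaf 2≤n q) start (λ { _ (late l) → ¬late-target l }) ℓ∈ (collector∈ (residue n))
    ... | _ , leaf , ℓ′∈ = ℓ′∈

    leaf∈ : ∀ n .{p} → leaf n p ∈ᵥ S
    leaf∈ 0 = leaf-of∈ 0F
    leaf∈ 1 = leaf-of∈ 1F
    leaf∈ 2 = leaf-of∈ 2F
    leaf∈ (suc n@(suc (suc _))) {p} = next-leaf∈ (s≤s (s≤s z≤n)) (leaf∈ n {<-trans (n<1+n n) p})

    root∈ : root ∈ᵥ S
    root∈ =
      passes-through from-first-leaf start (λ { _ (dead ¬3) → ¬3 leaf }) (leaf∈ 0 {≤-lit}) (leaf∈ 3 {≤-lit})

    vertex∈ : ∀ x → x ∈ᵥ S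
    vertex∈ root            = root∈
    vertex∈ (collector e)   = collector∈ e
    vertex∈ (distributor e) = distributor∈ e
    vertex∈ (link e)        = distributor⇒link (distributor∈ e)
    vertex∈ (feeder e)      = feeder∈ e
    vertex∈ (leaf n _)      = leaf∈ n

  only-trivial : OnlyTrivialTCCs _<_ 3 labelling
  only-trivial S big tcc = all-in (InClosedTCC.vertex∈ tcc big)

mainTheorem7 :
    (Σ ℕ λ L → ∀ (n : ℕ) → Σ ℕ λ k → Σ (TLabel k) λ lab →
        n ≤ k × Happy lab × LifetimeAtMost L lab
        × TemporallyConnected _≤_ lab × OnlyTrivialTCCs _≤_ 2 lab)
    ×
    (Σ ℕ λ L → ∀ (n : ℕ) → Σ ℕ λ k → Σ (TLabel k) λ lab →
        n ≤ k × Loopless lab × Symmetric lab × LifetimeAtMost L lab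
        × TemporallyConnected _<_ lab × OnlyTrivialTCCs _<_ 3 lab)
mainTheorem7 =
  (7 , λ n → let open Directed n in
     order , labelling , m≤n+m n 9 , happy , lifetime≤7 , connected , only-trivial) ,
  (8 , λ n → let open Undirected n in
     order , labelling , m≤n+m n 17 , no-loops , symmetric , lifetime≤8 , connected , only-trivial)
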